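{- Let $\ell_1,\ell_2$ be integers with $1<\ell_1<\ell_2-1$, let $\mathscr{M}=\{(a,b)\in\mathbb{Z}^2: 0\le a\le\ell_1-1,\ 0\le b\le\ell_2-1\}$ with the componentwise order, and let $\mathrm{wt}$ be a rank increasing and rank constant weight function on $\mathscr{M}$. Let $A\subseteq\mathscr{M}$ be a downset. (1) If $A$ is the initial segment of size $|A|$ of $\mathcal{C}$, then $A$ is optimal if and only if $|A|\le\ell_1$ or $|A|\ge\ell_1(\ell_2-1)$. (2) If $A$ is the initial segment of size $|A|$ of $\mathcal{L}$, then $A$ is optimal.
   Context: The rank of $(a,b)$ is $a+b$; $\mathrm{wt}$ is rank constant if equal ranks give equal weights and rank increasing if strictly smaller rank gives strictly smaller weight; $\mathrm{wt}(S)=\sum_{s\in S}\mathrm{wt}(s)$. A downset is a subset closed downward in the componentwise order; it is optimal if its weight is at least that of every downset of the same size. $\mathcal{L}$: $(a,b)<(c,d)$ iff $a<c$, or $a=c$ and $b<d$. $\mathcal{C}$: $(a,b)<(c,d)$ iff $b<d$, or $b=d$ and $a<c$. The initial segment of size $m$ is the set of the $m$ smallest elements.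
   Formalization: The weight function wt takes rational values rather than values in ℝ. -}

module Defs where

open import Data.Nat using (ℕ; zero; suc; _+_; _<_; _≤_)
open import Data.Fin using (Fin; toℕ)
import Data.Fin as F
open import Data.Bool using (Bool; true; false; if_then_else_)
open import Data.Rational using (ℚ; 0ℚ) renaming (_+_ to _+ℚ_; _<_ to _<ℚ_; _≤_ to _≤ℚ_)
open import Data.Product using (_×_; _,_; proj₁; proj₂)
open import Data.Sum using (_⊎_)
open import Relation.Binary.PropositionalEquality using (_≡_; _≢_)

sumℚ : (n : ℕ) → (Fin n → ℚ) → ℚ
sumℚ zero    f = 0ℚ
sumℚ (suc n) f = f F.zero +ℚ sumℚ n (λ i → f (F.suc i))

sumℕ : (n : ℕ) → (Fin n → ℕ) → ℕ
sumℕ zero    f = 0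
sumℕ (suc n) f = f F.zero + sumℕ n (λ i → f (F.suc i))

-- The poset M = [0,ℓ₁-1] × [0,ℓ₂-1]; an element is a pair (a , b) : Fin ℓ₁ × Fin ℓ₂.
-- A subset of M is given by its (decidable) characteristic function.
Subset : ℕ → ℕ → Set
Subset ℓ₁ ℓ₂ = Fin ℓ₁ → Fin ℓ₂ → Bool

Weight : ℕ → ℕ → Set
Weight ℓ₁ ℓ₂ = Fin ℓ₁ → Fin ℓ₂ → ℚ

module _ {ℓ₁ ℓ₂ : ℕ} where

  _∈_ : Fin ℓ₁ × Fin ℓ₂ → Subset ℓ₁ ℓ₂ → Set
  _∈_ x S = S (proj₁ x) (proj₂ x) ≡ true

  _∉_ : Fin ℓ₁ × Fin ℓ₂ → Subset ℓ₁ ℓ₂ → Set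
  _∉_ x S = S (proj₁ x) (proj₂ x) ≡ false

  rank : Fin ℓ₁ → Fin ℓ₂ → ℕ
  rank a b = toℕ a + toℕ b

  RankConstant : Weight ℓ₁ ℓ₂ → Set
  RankConstant wt = ∀ a b c d → rank a b ≡ rank c d → wt a b ≡ wt c d

  RankIncreasing : Weight ℓ₁ ℓ₂ → Set
  RankIncreasing wt = ∀ a b c d → rank a b < rank c d → wt a b <ℚ wt c d

  size : Subset ℓ₁ ℓ₂ → ℕ
  size S = sumℕ ℓ₁ (λ a → sumℕ ℓ₂ (λ b → if S a b then 1 else 0))

  weight : Weight ℓ₁ ℓ₂ → Subset ℓ₁ ℓ₂ → ℚ
  weight wt S = sumℚ ℓ₁ (λ a → sumℚ ℓ₂ (λ b → if S a b then wt a b else 0ℚ))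

  Downset : Subset ℓ₁ ℓ₂ → Set
  Downset S = ∀ a b c d → S c d ≡ true → toℕ a ≤ toℕ c → toℕ b ≤ toℕ d → S a b ≡ true

  Optimal : Weight ℓ₁ ℓ₂ → Subset ℓ₁ ℓ₂ → Set
  Optimal wt A = Downset A × (∀ B → Downset B → size B ≡ size A → weight wt B ≤ℚ weight wt A)

  _<L_ : Fin ℓ₁ × Fin ℓ₂ → Fin ℓ₁ × Fin ℓ₂ → Set
  (a , b) <L (c , d) = (toℕ a < toℕ c) ⊎ ((toℕ a ≡ toℕ c) × (toℕ b < toℕ d))

  _<C_ : Fin ℓ₁ × Fin ℓ₂ → Fin ℓ₁ × Fin ℓ₂ → Set
  (a , b) <C (c , d) = (toℕ b < toℕ d) ⊎ ((toℕ b ≡ toℕ d) × (toℕ a < toℕ c))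

  -- S is the initial segment of size |S| of the (strict total) order _≺_:
  -- S consists of the |S| smallest elements, i.e. every element of S is
  -- smaller than every element outside S.
  IsInitialSegment : (Fin ℓ₁ × Fin ℓ₂ → Fin ℓ₁ × Fin ℓ₂ → Set) → Subset ℓ₁ ℓ₂ → Set
  IsInitialSegment _≺_ S = ∀ x y → x ∈ S → y ∉ S → x ≺ y

{-# OPTIONS --safe #-}
module Submission where

-- A downset is a Young diagram, recorded by its non-increasing column heights. For a rank-constant
-- weight ω, Abel summation writes its weight as a positive combination of the counts cells≥ t of cells
-- of rank ≥ t, so a diagram with at least as many such cells for every t weighs at least as much, and
-- strictly more when one count is strictly larger and ω is strictly increasing. These counts are
-- invariant under transposition. In an n × n square the balanced diagram (column heights differing by at
-- most one) has the largest counts among diagrams of its size, by induction on n: a full first column is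
-- removed by transposing the remaining columns. The transpose of a balanced diagram with n columns is a
-- lexicographic segment, so those are optimal. A colexicographic segment is the balanced diagram with ℓ₁
-- columns; it has the same counts as the lexicographic segment when it has at most one row or misses at
-- most one row, and otherwise strictly fewer cells of some rank, so it is not optimal.

open import Defs
open import Data.Nat
open import Data.Nat.Properties
open import Data.Nat.DivMod using (_/_; _%_; m%n<n; m≡m%n+[m/n]*n)
open import Data.Nat.ListAction using (sum)
open import Data.Nat.ListAction.Properties using (sum-++)
open import Data.Nat.Tactic.RingSolver using (solve-∀)
open import Data.List using (List; []; _∷_; _++_; [_]; length; replicate; map)
open import Data.List.Properties using (length-++; length-replicate; map-replicate; map-++; ++-assoc; ∷-injectiveˡ; ∷-injectiveʳ)
open import Data.List.Relation.Unary.All as All using (All; []; _∷_)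
open import Data.List.Relation.Unary.All.Properties as All using (replicate⁺; ++⁺; ++⁻ʳ)
open import Data.List.Relation.Unary.AllPairs as AllPairs using (AllPairs; []; _∷_)
import Data.List.Relation.Unary.AllPairs.Properties as AllPairs
open import Data.List.Extrema.Nat using (max; xs≤max; ⊥≤max)
open import Data.Rational as ℚ using (ℚ; 0ℚ; 1ℚ)
import Data.Rational.Properties as ℚ
open import Data.Rational.Solver using (module +-*-Solver)
open import Data.Fin as Fin using (Fin; toℕ)
open import Data.Fin.Properties using (toℕ<n; toℕ-fromℕ<)
open import Data.Bool using (Bool; true; false; if_then_else_; T)
open import Data.Product using (_×_; _,_; ∃-syntax)
open import Data.Sum using (_⊎_; inj₁; inj₂; [_,_]′)
open import Function using (_∘′_)
open import Function.Bundles using (_⇔_; mk⇔)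
open import Data.Empty using (⊥; ⊥-elim)
open import Relation.Binary.PropositionalEquality hiding ([_])
open import Relation.Nullary using (¬_; yes; no; contradiction)
open import Relation.Binary.Definitions using (tri<; tri≈; tri>)

-- Diagrams and their rank counts

NonIncreasing : List ℕ → Set
NonIncreasing = AllPairs _≥_

-- The number of cells (a , b) with b < hs[a] and a + b ≥ t.
cells≥ : ℕ → List ℕ → ℕ
cells≥ t []       = 0
cells≥ t (h ∷ hs) = (h ∸ t) + cells≥ (t ∸ 1) hs

infix 4 _≼_ _≃_

_≼_ : List ℕ → List ℕ → Set
hs ≼ ks = ∀ t → cells≥ t hs ≤ cells≥ t ks

_≃_ : List ℕ → List ℕ → Set
hs ≃ ks = ∀ t → cells≥ t hs ≡ cells≥ t ks

cells≥-0 : ∀ hs → cells≥ 0 hs ≡ sum hs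
cells≥-0 []       = refl
cells≥-0 (h ∷ hs) = cong (h +_) (cells≥-0 hs)

cells≥-zeros : ∀ t {hs} → All (_≤ 0) hs → cells≥ t hs ≡ 0
cells≥-zeros t []          = refl
cells≥-zeros t (z≤n ∷ ps) = cong₂ _+_ (0∸n≡0 t) (cells≥-zeros (t ∸ 1) ps)

cells≥-++ : ∀ t xs ys → cells≥ t (xs ++ ys) ≡ cells≥ t xs + cells≥ (t ∸ length xs) ys
cells≥-++ t []       ys = refl
cells≥-++ t (x ∷ xs) ys
  rewrite cells≥-++ (t ∸ 1) xs ys | ∸-+-assoc t 1 (length xs) = sym (+-assoc (x ∸ t) _ _)

≃⇒sum≡ : ∀ {hs ks} → hs ≃ ks → sum hs ≡ sum ks
≃⇒sum≡ {hs} {ks} eq = trans (sym (cells≥-0 hs)) (trans (eq 0) (cells≥-0 ks))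

-- Transposition

positives : List ℕ → ℕ
positives []           = 0
positives (zero  ∷ hs) = positives hs
positives (suc _ ∷ hs) = suc (positives hs)

positives≤length : ∀ hs → positives hs ≤ length hs
positives≤length []           = z≤n
positives≤length (zero  ∷ hs) = m≤n⇒m≤1+n (positives≤length hs)
positives≤length (suc _ ∷ hs) = s≤s (positives≤length hs)

positives-pred : ∀ hs → positives (map pred hs) ≤ positives hs
positives-pred []                 = z≤n
positives-pred (zero        ∷ hs) = positives-pred hs
positives-pred (suc zero    ∷ hs) = m≤n⇒m≤1+n (positives-pred hs)
positives-pred (suc (suc _) ∷ hs) = s≤s (positives-pred hs)

positives-zeros : ∀ {hs} → All (_≤ 0) hs → positives hs ≡ 0
positives-zeros []         = refl
positives-zeros (z≤n ∷ ps) = positives-zeros ps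

positives-pos : ∀ {hs} → All (0 <_) hs → positives hs ≡ length hs
positives-pos []              = refl
positives-pos (s≤s z≤n ∷ ps) = cong suc (positives-pos ps)

NonIncreasing-pred : ∀ {hs} → NonIncreasing hs → NonIncreasing (map pred hs)
NonIncreasing-pred ni = AllPairs.map⁺ (AllPairs.map pred-mono-≤ ni)

All≤-pred : ∀ {H hs} → All (_≤ suc H) hs → All (_≤ H) (map pred hs)
All≤-pred ps = All.map⁺ (All.map pred-mono-≤ ps)

∸-swap-suc : ∀ t h p → (suc h ∸ t) + (p ∸ (t ∸ 1)) ≡ (suc p ∸ t) + (h ∸ (t ∸ 1))
∸-swap-suc zero    h p = cong suc (+-comm h p)
∸-swap-suc (suc t) h p = +-comm (h ∸ t) (p ∸ t)

-- Deleting the bottom row of a non-increasing diagram lowers every cell's rank by one.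
cells≥-bottomRow : ∀ t {hs} → NonIncreasing hs →
                   cells≥ t hs ≡ (positives hs ∸ t) + cells≥ (t ∸ 1) (map pred hs)
cells≥-bottomRow t {[]} _ = sym (trans (+-identityʳ _) (0∸n≡0 t))
cells≥-bottomRow t {zero ∷ hs} (ps ∷ _) = begin
  (0 ∸ t) + cells≥ (t ∸ 1) hs                                  ≡⟨ cong₂ _+_ (0∸n≡0 t) (cells≥-zeros (t ∸ 1) ps) ⟩
  0                                                             ≡⟨ sym (cong₂ _+_ positives-vanish (cells≥-zeros (t ∸ 1) pred-zeros)) ⟩
  (positives hs ∸ t) + cells≥ (t ∸ 1) (0 ∷ map pred hs)         ∎
  where
  open ≡-Reasoning
  positives-vanish : positives hs ∸ t ≡ 0
  positives-vanish = trans (cong (_∸ t) (positives-zeros ps)) (0∸n≡0 t)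
  pred-zeros : All (_≤ 0) (0 ∷ map pred hs)
  pred-zeros = z≤n ∷ All≤-pred (All.map m≤n⇒m≤1+n ps)
cells≥-bottomRow t {suc h ∷ hs} (_ ∷ ni) = begin
  (suc h ∸ t) + cells≥ (t ∸ 1) hs
    ≡⟨ cong ((suc h ∸ t) +_) (cells≥-bottomRow (t ∸ 1) ni) ⟩
  (suc h ∸ t) + ((positives hs ∸ (t ∸ 1)) + rest)
    ≡⟨ sym (+-assoc (suc h ∸ t) _ rest) ⟩
  (suc h ∸ t) + (positives hs ∸ (t ∸ 1)) + rest
    ≡⟨ cong (_+ rest) (∸-swap-suc t h (positives hs)) ⟩
  (suc (positives hs) ∸ t) + (h ∸ (t ∸ 1)) + rest
    ≡⟨ +-assoc (suc (positives hs) ∸ t) _ rest ⟩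
  (suc (positives hs) ∸ t) + ((h ∸ (t ∸ 1)) + rest)             ∎
  where
  open ≡-Reasoning
  rest = cells≥ (t ∸ 1 ∸ 1) (map pred hs)

conjugate : ℕ → List ℕ → List ℕ
conjugate zero    hs = []
conjugate (suc H) hs = positives hs ∷ conjugate H (map pred hs)

cells≥-conjugate : ∀ H t {hs} → NonIncreasing hs → All (_≤ H) hs →
                   cells≥ t (conjugate H hs) ≡ cells≥ t hs
cells≥-conjugate zero    t ni ps = sym (cells≥-zeros t ps)
cells≥-conjugate (suc H) t {hs} ni ps = begin
  (positives hs ∸ t) + cells≥ (t ∸ 1) (conjugate H (map pred hs))
    ≡⟨ cong ((positives hs ∸ t) +_) (cells≥-conjugate H (t ∸ 1) (NonIncreasing-pred ni) (All≤-pred ps)) ⟩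
  (positives hs ∸ t) + cells≥ (t ∸ 1) (map pred hs)
    ≡⟨ sym (cells≥-bottomRow t ni) ⟩
  cells≥ t hs ∎
  where open ≡-Reasoning

conjugate≃ : ∀ H {hs} → NonIncreasing hs → All (_≤ H) hs → conjugate H hs ≃ hs
conjugate≃ H ni ps t = cells≥-conjugate H t ni ps

length-conjugate : ∀ H hs → length (conjugate H hs) ≡ H
length-conjugate zero    hs = refl
length-conjugate (suc H) hs = cong suc (length-conjugate H (map pred hs))

conjugate-bounded : ∀ H hs {b} → positives hs ≤ b → All (_≤ b) (conjugate H hs)
conjugate-bounded zero    hs p = []
conjugate-bounded (suc H) hs p = p ∷ conjugate-bounded H (map pred hs) (≤-trans (positives-pred hs) p)

conjugate-≤length : ∀ H hs → All (_≤ length hs) (conjugate H hs)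
conjugate-≤length H hs = conjugate-bounded H hs (positives≤length hs)

NonIncreasing-conjugate : ∀ H hs → NonIncreasing (conjugate H hs)
NonIncreasing-conjugate zero    hs = []
NonIncreasing-conjugate (suc H) hs =
  conjugate-bounded H (map pred hs) (positives-pred hs) ∷ NonIncreasing-conjugate H (map pred hs)

-- Balanced diagrams

balanced : ℕ → ℕ → ℕ → List ℕ
balanced n q r = replicate r (suc q) ++ replicate (n ∸ r) q

length-balanced : ∀ {n} q {r} → r ≤ n → length (balanced n q r) ≡ n
length-balanced {n} q {r} r≤n = begin
  length (replicate r (suc q) ++ replicate (n ∸ r) q)   ≡⟨ length-++ (replicate r (suc q)) ⟩
  length (replicate r (suc q)) + length (replicate (n ∸ r) q)
                                                         ≡⟨ cong₂ _+_ (length-replicate r) (length-replicate (n ∸ r)) ⟩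
  r + (n ∸ r)                                            ≡⟨ m+[n∸m]≡n r≤n ⟩
  n                                                      ∎
  where open ≡-Reasoning

sum-replicate : ∀ k a → sum (replicate k a) ≡ k * a
sum-replicate zero    a = refl
sum-replicate (suc k) a = cong (a +_) (sum-replicate k a)

sum-balanced : ∀ {n} q {r} → r ≤ n → sum (balanced n q r) ≡ q * n + r
sum-balanced {n} q {r} r≤n = begin
  sum (replicate r (suc q) ++ replicate (n ∸ r) q)      ≡⟨ sum-++ (replicate r (suc q)) _ ⟩
  sum (replicate r (suc q)) + sum (replicate (n ∸ r) q) ≡⟨ cong₂ _+_ (sum-replicate r (suc q)) (sum-replicate (n ∸ r) q) ⟩
  r * suc q + (n ∸ r) * q                                ≡⟨ regroup r q (n ∸ r) ⟩
  q * (r + (n ∸ r)) + r                                  ≡⟨ cong (λ k → q * k + r) (m+[n∸m]≡n r≤n) ⟩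
  q * n + r                                              ∎
  where
  open ≡-Reasoning
  regroup : ∀ r q k → r * suc q + k * q ≡ q * (r + k) + r
  regroup = solve-∀

balanced-bounded : ∀ n q r {b} → suc q ≤ b → All (_≤ b) (balanced n q r)
balanced-bounded n q r q<b = ++⁺ (replicate⁺ r q<b) (replicate⁺ (n ∸ r) (<⇒≤ q<b))

NonIncreasing-balanced : ∀ n q r → NonIncreasing (balanced n q r)
NonIncreasing-balanced n q r = steps r (n ∸ r)
  where
  lows : ∀ k → NonIncreasing (replicate k q)
  lows zero    = []
  lows (suc k) = replicate⁺ k ≤-refl ∷ lows k
  steps : ∀ r k → NonIncreasing (replicate r (suc q) ++ replicate k q)
  steps zero    k = lows k
  steps (suc r) k = ++⁺ (replicate⁺ r ≤-refl) (replicate⁺ k (n≤1+n q)) ∷ steps r k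

cells≥-ones : ∀ t r → cells≥ t (replicate r 1) ≡ r ∸ t
cells≥-ones t       zero    = sym (0∸n≡0 t)
cells≥-ones zero    (suc r) = cong suc (cells≥-ones 0 r)
cells≥-ones (suc t) (suc r) = cong₂ _+_ (0∸n≡0 t) (cells≥-ones t r)

cells≥-balanced₀ : ∀ t n r → cells≥ t (balanced n 0 r) ≡ r ∸ t
cells≥-balanced₀ t n r = begin
  cells≥ t (replicate r 1 ++ replicate (n ∸ r) 0)
    ≡⟨ cells≥-++ t (replicate r 1) _ ⟩
  cells≥ t (replicate r 1) + cells≥ (t ∸ length (replicate r 1)) (replicate (n ∸ r) 0)
    ≡⟨ cong₂ _+_ (cells≥-ones t r) (cells≥-zeros _ (replicate⁺ (n ∸ r) z≤n)) ⟩
  (r ∸ t) + 0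
    ≡⟨ +-identityʳ _ ⟩
  r ∸ t ∎
  where open ≡-Reasoning

pred-balanced : ∀ n q r → map pred (balanced n (suc q) r) ≡ balanced n q r
pred-balanced n q r = trans (map-++ pred (replicate r (suc (suc q))) _)
  (cong₂ _++_ (map-replicate pred r (suc (suc q))) (map-replicate pred (n ∸ r) (suc q)))

positives-balanced : ∀ {n} q {r} → r ≤ n → positives (balanced n (suc q) r) ≡ n
positives-balanced {n} q {r} r≤n =
  trans (positives-pos (++⁺ (replicate⁺ r (s≤s z≤n)) (replicate⁺ (n ∸ r) (s≤s z≤n))))
        (length-balanced (suc q) r≤n)

cells≥-balanced-suc : ∀ t {n} q {r} → r ≤ n →
                      cells≥ t (balanced n (suc q) r) ≡ (n ∸ t) + cells≥ (t ∸ 1) (balanced n q r)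
cells≥-balanced-suc t {n} q {r} r≤n =
  trans (cells≥-bottomRow t (NonIncreasing-balanced n (suc q) r))
        (cong₂ _+_ (cong (_∸ t) (positives-balanced q r≤n)) (cong (cells≥ (t ∸ 1)) (pred-balanced n q r)))

cells≥-∷-balanced : ∀ t {n} p q {r} → r ≤ n →
                    cells≥ t (suc p ∷ balanced n (suc q) r) ≡ (suc n ∸ t) + cells≥ (t ∸ 1) (p ∷ balanced n q r)
cells≥-∷-balanced t {n} p q {r} r≤n = begin
  (suc p ∸ t) + cells≥ (t ∸ 1) (balanced n (suc q) r)
    ≡⟨ cong ((suc p ∸ t) +_) (cells≥-balanced-suc (t ∸ 1) q r≤n) ⟩
  (suc p ∸ t) + ((n ∸ (t ∸ 1)) + rest)
    ≡⟨ sym (+-assoc (suc p ∸ t) _ rest) ⟩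
  (suc p ∸ t) + (n ∸ (t ∸ 1)) + rest
    ≡⟨ cong (_+ rest) (∸-swap-suc t p n) ⟩
  (suc n ∸ t) + (p ∸ (t ∸ 1)) + rest
    ≡⟨ +-assoc (suc n ∸ t) _ rest ⟩
  (suc n ∸ t) + ((p ∸ (t ∸ 1)) + rest) ∎
  where
  open ≡-Reasoning
  rest = cells≥ (t ∸ 1 ∸ 1) (balanced n q r)

conjugate-balanced : ∀ {n} q {r} → r ≤ n → conjugate (suc q) (balanced n q r) ≡ replicate q n ++ [ r ]
conjugate-balanced {n} zero    {r} r≤n =
  cong [_] (trans (positives-ones r) (trans (cong (r +_) (positives-zeros (replicate⁺ (n ∸ r) z≤n))) (+-identityʳ r)))
  where
  positives-ones : ∀ r {hs} → positives (replicate r 1 ++ hs) ≡ r + positives hs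
  positives-ones zero    = refl
  positives-ones (suc r) = cong suc (positives-ones r)
conjugate-balanced {n} (suc q) {r} r≤n = cong₂ _∷_ (positives-balanced q r≤n)
  (trans (cong (conjugate (suc q)) (pred-balanced n q r)) (conjugate-balanced q r≤n))

-- Transposed, a balanced diagram is q full rows of length n and a row of length r.
balanced≃rows : ∀ {n} q {r} → r ≤ n → balanced n q r ≃ replicate q n ++ [ r ]
balanced≃rows {n} q {r} r≤n t = begin
  cells≥ t (balanced n q r)
    ≡⟨ sym (cells≥-conjugate (suc q) t (NonIncreasing-balanced n q r) (balanced-bounded n q r ≤-refl)) ⟩
  cells≥ t (conjugate (suc q) (balanced n q r))
    ≡⟨ cong (cells≥ t) (conjugate-balanced q r≤n) ⟩
  cells≥ t (replicate q n ++ [ r ]) ∎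
  where open ≡-Reasoning

-- Domination by the balanced diagram

∸-superadditive : ∀ k a b → (a ∸ k) + (b ∸ k) ≤ (a + b) ∸ k
∸-superadditive zero    a       b       = ≤-refl
∸-superadditive (suc k) zero    b       = ≤-reflexive (cong (_+ (b ∸ suc k)) (0∸n≡0 (suc k)))
∸-superadditive (suc k) (suc a) zero    = ≤-reflexive (trans (+-identityʳ _) (cong (_∸ suc k) (sym (+-identityʳ (suc a)))))
∸-superadditive (suc k) (suc a) (suc b) = ≤-trans (∸-superadditive k a b) (∸-monoˡ-≤ k (+-monoʳ-≤ a (n≤1+n b)))

∸-majorization : ∀ s a b c d → a + b ≡ c + d → a ≤ c → b ≤ c → (a ∸ s) + (b ∸ s) ≤ (c ∸ s) + (d ∸ s)
∸-majorization zero    a       b       c       d       eq _         _         = ≤-reflexive eq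
∸-majorization (suc s) zero    b       c       d       _  _         b≤c       =
  ≤-trans (∸-monoˡ-≤ (suc s) b≤c) (m≤m+n _ _)
∸-majorization (suc s) (suc a) zero    c       d       _  a≤c       _         =
  ≤-trans (≤-reflexive (+-identityʳ _)) (≤-trans (∸-monoˡ-≤ (suc s) a≤c) (m≤m+n _ _))
∸-majorization (suc s) (suc a) (suc b) (suc c) zero    eq _         _         =
  ≤-trans (∸-superadditive (suc s) (suc a) (suc b))
          (≤-trans (∸-monoˡ-≤ (suc s) (≤-reflexive (trans eq (+-identityʳ _)))) (m≤m+n _ _))
∸-majorization (suc s) (suc a) (suc b) (suc c) (suc d) eq (s≤s a≤c) (s≤s b≤c) =
  ∸-majorization s a b c d (suc-injective (trans (sym (+-suc a b)) (trans (cong pred eq) (+-suc c d)))) a≤c b≤c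

two-columns≤column : ∀ t p r → (p ≡ 0 → r ≡ 0) → (p ∸ t) + (r ∸ (t ∸ 1)) ≤ (p + r) ∸ t
two-columns≤column zero    p       r _ = ≤-refl
two-columns≤column (suc t) zero    r p≡0⇒r≡0 rewrite p≡0⇒r≡0 refl | 0∸n≡0 t = z≤n
two-columns≤column (suc t) (suc p) r _ = ∸-superadditive t p r

two-columns≤two-columns : ∀ t p r n R → p + r ≡ suc n + R → p ≤ n → r ≤ n →
                          (p ∸ t) + (r ∸ (t ∸ 1)) ≤ (suc n ∸ t) + (R ∸ (t ∸ 1))
two-columns≤two-columns zero    p       r n R eq  _    _   = ≤-reflexive eq
two-columns≤two-columns (suc t) zero    r n R eq  _    r≤n =
  contradiction (≤-trans (m≤m+n (suc n) R) (≤-reflexive (sym eq))) (<⇒≱ (s≤s r≤n))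
two-columns≤two-columns (suc t) (suc p) r n R eq  p<n r≤n =
  ∸-majorization t p r n R (cong pred eq) (≤-trans (n≤1+n p) p<n) r≤n

private
  peel-total : ∀ n p q r Q R → suc p + (suc q * n + r) ≡ suc Q * suc n + R → p + (q * n + r) ≡ Q * suc n + R
  peel-total n p q r Q R eq = +-cancelˡ-≡ (suc n) _ _ (trans (lhs n p q r) (trans eq (rhs n Q R)))
    where
    lhs : ∀ n p q r → suc n + (p + (q * n + r)) ≡ suc p + (suc q * n + r)
    lhs = solve-∀
    rhs : ∀ n Q R → suc Q * suc n + R ≡ suc n + (Q * suc n + R)
    rhs = solve-∀

  peel-height : ∀ n p q r → suc q * n + r ≤ suc p * n → q * n + r ≤ p * n
  peel-height n p q r h = +-cancelˡ-≤ n _ _ (≤-trans (≤-reflexive (sym (+-assoc n (q * n) r))) h)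

  two-columns-total : ∀ n p r Q R → p ≤ n → r < n → p + r ≡ suc (suc Q) * suc n + R → ⊥
  two-columns-total n p r Q R p≤n r<n eq = <⇒≱ small big
    where
    small : p + r < suc n + suc n
    small = s≤s (≤-trans (+-mono-≤ p≤n (<⇒≤ r<n)) (+-monoʳ-≤ n (n≤1+n n)))
    big : suc n + suc n ≤ p + r
    big = begin
      suc n + suc n                 ≡⟨ cong (suc n +_) (sym (+-identityʳ (suc n))) ⟩
      suc n + (suc n + 0)           ≤⟨ +-monoʳ-≤ (suc n) (+-monoʳ-≤ (suc n) z≤n) ⟩
      suc (suc Q) * suc n           ≤⟨ m≤m+n _ R ⟩
      suc (suc Q) * suc n + R       ≡⟨ sym eq ⟩
      p + r                         ∎
      where open ≤-Reasoning

  column-total : ∀ n p q r R → R < suc n → suc p + (suc q * n + r) ≡ R → ⊥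
  column-total n p q r R R≤n eq = <⇒≱ R≤n (begin
    suc n                         ≤⟨ s≤s (m≤m+n n (q * n + r)) ⟩
    suc (n + (q * n + r))         ≡⟨ cong suc (sym (+-assoc n (q * n) r)) ⟩
    suc (suc q * n + r)           ≤⟨ s≤s (m≤n+m _ p) ⟩
    suc p + (suc q * n + r)       ≡⟨ eq ⟩
    R                             ∎)
    where open ≤-Reasoning

  empty-column : ∀ n q r → r < n → suc q * n + r ≤ 0 → ⊥
  empty-column (suc n) q r _ ()

-- The hypothesis q n + r ≤ p n says the new column p is at least as high as the diagram behind it.
column∷balanced≼balanced : ∀ n p q r Q R → p ≤ n → r < n → R < suc n →
                           p + (q * n + r) ≡ Q * suc n + R → q * n + r ≤ p * n →
                           p ∷ balanced n q r ≼ balanced (suc n) Q R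
column∷balanced≼balanced n p zero r zero R p≤n r<n R≤n refl below t
  rewrite cells≥-balanced₀ (t ∸ 1) n r | cells≥-balanced₀ t (suc n) (p + r) =
  two-columns≤column t p r λ { refl → n≤0⇒n≡0 below }
column∷balanced≼balanced n p zero r (suc zero) R p≤n r<n R≤n eq below t
  rewrite cells≥-balanced₀ (t ∸ 1) n r | cells≥-balanced-suc t 0 (<⇒≤ R≤n) | cells≥-balanced₀ (t ∸ 1) (suc n) R =
  two-columns≤two-columns t p r n R (trans eq (cong (_+ R) (+-identityʳ (suc n)))) p≤n (<⇒≤ r<n)
column∷balanced≼balanced n p zero r (suc (suc Q)) R p≤n r<n R≤n eq below t =
  ⊥-elim (two-columns-total n p r Q R p≤n r<n eq)
column∷balanced≼balanced n zero (suc q) r Q R p≤n r<n R≤n eq below t =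
  ⊥-elim (empty-column n q r r<n below)
column∷balanced≼balanced n (suc p) (suc q) r zero R p≤n r<n R≤n eq below t =
  ⊥-elim (column-total n p q r R R≤n eq)
column∷balanced≼balanced n (suc p) (suc q) r (suc Q) R p<n r<n R≤n eq below t
  rewrite cells≥-∷-balanced t p q (<⇒≤ r<n) | cells≥-balanced-suc t Q (<⇒≤ R≤n) =
  +-monoʳ-≤ (suc n ∸ t)
    (column∷balanced≼balanced n p q r Q R (≤-trans (n≤1+n p) p<n) r<n R≤n
       (peel-total n p q r Q R eq) (peel-height n p q r below) (t ∸ 1))

sum≤length*bound : ∀ {b} hs → All (_≤ b) hs → sum hs ≤ length hs * b
sum≤length*bound []       []       = z≤n
sum≤length*bound (h ∷ hs) (p ∷ ps) = +-mono-≤ p (sum≤length*bound hs ps)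

divMod : ∀ m n → ∃[ q ] ∃[ r ] (r < suc n × m ≡ q * suc n + r)
divMod m n = m / suc n , m % suc n , m%n<n m (suc n) , trans (m≡m%n+[m/n]*n m (suc n)) (+-comm (m % suc n) _)

SquareDominance : ℕ → Set
SquareDominance n = ∀ {hs} → NonIncreasing hs → length hs ≤ n → All (_≤ n) hs →
                    ∀ Q R → R < n → sum hs ≡ Q * n + R → hs ≼ balanced n Q R

wide≼balanced : ∀ n → SquareDominance n →
                ∀ {hs} → NonIncreasing hs → length hs ≤ suc n → All (_≤ n) hs →
                ∀ Q R → R < suc n → sum hs ≡ Q * suc n + R → hs ≼ balanced (suc n) Q R
wide≼balanced n       square {[]}        _         _         _         Q R _   _  t = z≤n
wide≼balanced zero    square {h ∷ []}    _         _         (z≤n ∷ _) Q R _   _  t =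
  ≤-trans (≤-reflexive (trans (+-identityʳ _) (0∸n≡0 t))) z≤n
wide≼balanced zero    square {_ ∷ _ ∷ _} _         (s≤s ()) _         Q R _   _  t
wide≼balanced (suc n) square {p ∷ hs}    (ps ∷ ni) (s≤s len) (p≤n ∷ _) Q R R<n eq t with divMod (sum hs) n
... | q , r , r<n , eq′ =
  ≤-trans (+-monoʳ-≤ (p ∸ t) (square ni len (All.map (λ x≤p → ≤-trans x≤p p≤n) ps) q r r<n eq′ (t ∸ 1)))
          (column∷balanced≼balanced (suc n) p q r Q R p≤n r<n R<n (trans (cong (p +_) (sym eq′)) eq) below t)
  where
  below : q * suc n + r ≤ p * suc n
  below = begin
    q * suc n + r       ≡⟨ sym eq′ ⟩
    sum hs              ≤⟨ sum≤length*bound hs ps ⟩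
    length hs * p       ≤⟨ *-monoˡ-≤ p len ⟩
    suc n * p           ≡⟨ *-comm (suc n) p ⟩
    p * suc n           ∎
    where open ≤-Reasoning

-- A full first column is removed by transposing the rest, which then fits the (n + 1) × n rectangle.
fullColumn∷≼balanced : ∀ n → SquareDominance n →
                       ∀ {hs} → NonIncreasing hs → length hs ≤ n → All (_≤ suc n) hs →
                       ∀ Q R → R < suc n → suc n + sum hs ≡ Q * suc n + R → suc n ∷ hs ≼ balanced (suc n) Q R
fullColumn∷≼balanced n square {hs} ni len bnd zero R R<n eq =
  ⊥-elim (<⇒≱ R<n (≤-trans (m≤m+n (suc n) (sum hs)) (≤-reflexive eq)))
fullColumn∷≼balanced n square {hs} ni len bnd (suc Q) R R<n eq t = begin
  (suc n ∸ t) + cells≥ (t ∸ 1) hs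
    ≡⟨ cong ((suc n ∸ t) +_) (sym (cells≥-conjugate (suc n) (t ∸ 1) ni bnd)) ⟩
  (suc n ∸ t) + cells≥ (t ∸ 1) hsᵀ
    ≤⟨ +-monoʳ-≤ (suc n ∸ t) (hsᵀ≼ (t ∸ 1)) ⟩
  (suc n ∸ t) + cells≥ (t ∸ 1) (balanced (suc n) Q R)
    ≡⟨ sym (cells≥-balanced-suc t Q (<⇒≤ R<n)) ⟩
  cells≥ t (balanced (suc n) (suc Q) R) ∎
  where
  open ≤-Reasoning
  hsᵀ = conjugate (suc n) hs
  sum-hsᵀ : sum hsᵀ ≡ Q * suc n + R
  sum-hsᵀ = begin-equality
    sum hsᵀ         ≡⟨ ≃⇒sum≡ {hsᵀ} {hs} (conjugate≃ (suc n) ni bnd) ⟩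
    sum hs          ≡⟨ +-cancelˡ-≡ (suc n) _ _ (trans eq (+-assoc (suc n) (Q * suc n) R)) ⟩
    Q * suc n + R   ∎
  hsᵀ≼ : hsᵀ ≼ balanced (suc n) Q R
  hsᵀ≼ = wide≼balanced n square (NonIncreasing-conjugate (suc n) hs) (≤-reflexive (length-conjugate (suc n) hs))
           (All.map (λ x≤ → ≤-trans x≤ len) (conjugate-≤length (suc n) hs)) Q R R<n sum-hsᵀ

square≼balanced : ∀ n → SquareDominance n
square≼balanced zero    {hs}    _         _   _           Q R ()
square≼balanced (suc n) {[]}    _         _   _           Q R _   _ t = z≤n
square≼balanced (suc n) {h ∷ hs} (ps ∷ ni) len (h≤n ∷ bnd) Q R R<n eq with m≤n⇒m<n∨m≡n h≤n
... | inj₁ (s≤s h≤n′) =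
  wide≼balanced n (square≼balanced n) (ps ∷ ni) len (h≤n′ ∷ All.map (λ x≤h → ≤-trans x≤h h≤n′) ps) Q R R<n eq
... | inj₂ refl = fullColumn∷≼balanced n (square≼balanced n) ni (≤-pred len) bnd Q R R<n eq

-- Strict domination

infix 4 _≺_

_≺_ : List ℕ → List ℕ → Set
hs ≺ ks = ∃[ t ] cells≥ t hs < cells≥ t ks

∷-≼-≺ : ∀ p {hs ks ls} → hs ≼ ks → p ∷ ks ≺ ls → p ∷ hs ≺ ls
∷-≼-≺ p hs≼ks (t , lt) = t , ≤-<-trans (+-monoʳ-≤ (p ∸ t) (hs≼ks (t ∸ 1))) lt

∷-≺-≼ : ∀ p {hs ks ls} → hs ≺ ks → p ∷ ks ≼ ls → p ∷ hs ≺ ls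
∷-≺-≼ p (t , lt) ks≼ls = suc t , <-≤-trans (+-monoʳ-< (p ∸ suc t) lt) (ks≼ls (suc t))

column∷balanced≺balanced : ∀ n p q r Q R → p ≤ n → r < n → R < suc n →
                           p + (q * n + r) ≡ Q * suc n + R → q * n + r ≤ p * n → 1 ≤ r → suc (suc q) ≤ p →
                           p ∷ balanced n q r ≺ balanced (suc n) Q R
column∷balanced≺balanced n (suc (suc p)) zero (suc r) zero R _ _ _ refl _ _ _ = t , lt
  where
  t = suc p + suc r
  lt : cells≥ t (suc (suc p) ∷ balanced n 0 (suc r)) < cells≥ t (balanced (suc n) 0 (suc (suc p) + suc r))
  lt rewrite cells≥-balanced₀ (t ∸ 1) n (suc r) | cells≥-balanced₀ t (suc n) (suc (suc p) + suc r)
           | m≤n⇒m∸n≡0 {suc p} {p + suc r} (≤-trans (s≤s (m≤m+n p r)) (≤-reflexive (sym (+-suc p r))))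
           | m≤n⇒m∸n≡0 {suc r} {p + suc r} (m≤n+m (suc r) p)
           | m+n∸n≡m 1 (p + suc r) = s≤s z≤n
column∷balanced≺balanced n (suc zero) zero r zero R _ _ _ _ _ _ (s≤s ())
column∷balanced≺balanced n p zero r (suc zero) R p≤n r<n R≤n eq _ _ _ = n , lt
  where
  lt : cells≥ n (p ∷ balanced n 0 r) < cells≥ n (balanced (suc n) 1 R)
  lt rewrite cells≥-balanced₀ (n ∸ 1) n r | cells≥-balanced-suc n 0 (<⇒≤ R≤n) | cells≥-balanced₀ (n ∸ 1) (suc n) R
           | m≤n⇒m∸n≡0 p≤n | m≤n⇒m∸n≡0 (∸-monoˡ-≤ 1 r<n) | m+n∸n≡m 1 n = s≤s z≤n
column∷balanced≺balanced n p zero r (suc (suc Q)) R p≤n r<n _ eq _ _ _ = ⊥-elim (two-columns-total n p r Q R p≤n r<n eq)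
column∷balanced≺balanced n (suc p) (suc q) r zero R _ _ R≤n eq _ _ _ = ⊥-elim (column-total n p q r R R≤n eq)
column∷balanced≺balanced n (suc p) (suc q) r (suc Q) R p<n r<n R≤n eq below 1≤r (s≤s q+2≤p)
  with column∷balanced≺balanced n p q r Q R (≤-trans (n≤1+n p) p<n) r<n R≤n
         (peel-total n p q r Q R eq) (peel-height n p q r below) 1≤r q+2≤p
... | t , lt = suc t , lt′
  where
  lt′ : cells≥ (suc t) (suc p ∷ balanced n (suc q) r) < cells≥ (suc t) (balanced (suc n) (suc Q) R)
  lt′ rewrite cells≥-∷-balanced (suc t) p q (<⇒≤ r<n) | cells≥-balanced-suc (suc t) Q (<⇒≤ R≤n) =
    +-monoʳ-< (suc n ∸ suc t) lt

lead : ℕ → ℕ → ℕ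
lead zero    v = v
lead (suc s) v = suc v

balanced-∷ : ∀ c v s → balanced (suc c) v s ≡ lead s v ∷ balanced c v (s ∸ 1)
balanced-∷ c v zero    = refl
balanced-∷ c v (suc s) = refl

lead+sum : ∀ c v s → lead s v + (v * c + (s ∸ 1)) ≡ v * suc c + s
lead+sum c v zero    = regroup v c
  where
  regroup : ∀ v c → v + (v * c + 0) ≡ v * suc c + 0
  regroup = solve-∀
lead+sum c v (suc s) = regroup v c s
  where
  regroup : ∀ v c s → suc v + (v * c + s) ≡ v * suc c + suc s
  regroup = solve-∀

balanced≤lead : ∀ c v s → All (_≤ lead s v) (balanced c v (s ∸ 1))
balanced≤lead c v zero    = replicate⁺ (c ∸ 0) ≤-refl
balanced≤lead c v (suc s) = balanced-bounded c v s ≤-refl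

lead≤suc : ∀ s v → lead s v ≤ suc v
lead≤suc zero    v = n≤1+n v
lead≤suc (suc s) v = ≤-refl

≤lead : ∀ s v → v ≤ lead s v
≤lead zero    v = ≤-refl
≤lead (suc s) v = n≤1+n v

balanced∷≺balanced : ∀ c n v s Q R → c ≤ n → s ≤ c → v < n → R ≤ n → v * suc c + s ≡ Q * suc n + R →
                     ∀ q r → r < n → v * c + (s ∸ 1) ≡ q * n + r →
                     balanced c v (s ∸ 1) ≺ balanced n q r ⊎ (1 ≤ r × suc (suc q) ≤ lead s v) →
                     balanced (suc c) v s ≺ balanced (suc n) Q R
balanced∷≺balanced c n v s Q R c≤n s≤c v<n R≤n total q r r<n tail-total beaten
  rewrite balanced-∷ c v s = extend beaten
  where
  p = lead s v
  tl = balanced c v (s ∸ 1)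
  p≤n : p ≤ n
  p≤n = ≤-trans (lead≤suc s v) v<n
  sum-tl : sum tl ≡ q * n + r
  sum-tl = trans (sum-balanced v (≤-trans (m∸n≤m s 1) s≤c)) tail-total
  total′ : p + (q * n + r) ≡ Q * suc n + R
  total′ = trans (cong (p +_) (sym tail-total)) (trans (lead+sum c v s) total)
  len-tl : length tl ≤ n
  len-tl = ≤-trans (≤-reflexive (length-balanced v (≤-trans (m∸n≤m s 1) s≤c))) c≤n
  below : q * n + r ≤ p * n
  below = begin
    q * n + r       ≡⟨ sym sum-tl ⟩
    sum tl          ≤⟨ sum≤length*bound tl (balanced≤lead c v s) ⟩
    length tl * p   ≤⟨ *-monoˡ-≤ p len-tl ⟩
    n * p           ≡⟨ *-comm n p ⟩
    p * n           ∎
    where open ≤-Reasoning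
  extend : tl ≺ balanced n q r ⊎ (1 ≤ r × suc (suc q) ≤ p) → p ∷ tl ≺ balanced (suc n) Q R
  extend (inj₁ tl≺) =
    ∷-≺-≼ p {tl} {balanced n q r} {balanced (suc n) Q R} tl≺
      (column∷balanced≼balanced n p q r Q R p≤n r<n (s≤s R≤n) total′ below)
  extend (inj₂ (1≤r , q+2≤p)) =
    ∷-≼-≺ p {tl} {balanced n q r} {balanced (suc n) Q R}
      (square≼balanced n (NonIncreasing-balanced c v (s ∸ 1)) len-tl
         (All.map (λ x≤p → ≤-trans x≤p p≤n) (balanced≤lead c v s)) q r r<n sum-tl)
      (column∷balanced≺balanced n p q r Q R p≤n r<n (s≤s R≤n) total′ below 1≤r q+2≤p)

private
  quotient< : ∀ v k s n → v * suc k + s < n * suc k → v < n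
  quotient< v k s n lt = *-cancelʳ-< (suc k) v n (≤-<-trans (m≤m+n (v * suc k) s) lt)

  remainder-bound : ∀ v k x n → x < k → suc v ≤ n → v * k + x < n * k
  remainder-bound v k x n x<k v<n = begin-strict
    v * k + x     <⟨ +-monoʳ-< (v * k) x<k ⟩
    v * k + k     ≡⟨ +-comm (v * k) k ⟩
    suc v * k     ≤⟨ *-monoˡ-≤ k v<n ⟩
    n * k         ∎
    where open ≤-Reasoning

  <1*+ : ∀ k x → 1 ≤ x → k < 1 * k + x
  <1*+ k x 1≤x = ≤-trans (≤-trans (≤-reflexive (+-comm 1 k)) (+-monoʳ-≤ k 1≤x))
                         (≤-reflexive (cong (_+ x) (sym (*-identityˡ k))))

  <2*+ : ∀ k v x → 1 ≤ k → k < suc (suc v) * k + x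
  <2*+ k v x 1≤k = ≤-trans (+-monoˡ-≤ k 1≤k) (≤-trans (+-monoʳ-≤ k (m≤m+n k (v * k))) (m≤m+n _ x))

  +2≤⇒< : ∀ {c n} → c + 2 ≤ n → c < n
  +2≤⇒< {c} h = ≤-trans (≤-reflexive (+-comm 1 c)) (≤-trans (+-monoʳ-≤ c (s≤s z≤n)) h)

  pred≤ : ∀ {s c} → s ≤ suc c → s ∸ 1 ≤ c
  pred≤ {zero}  _         = z≤n
  pred≤ {suc s} (s≤s s≤c) = s≤c

  pred< : ∀ {s c} → 1 ≤ c → s ≤ c → s ∸ 1 < c
  pred< {zero}  1≤c _   = 1≤c
  pred< {suc s} _   s≤c = s≤c

-- Peel off the first column until the rest is ragged enough for column∷balanced≺balanced: this happens
-- at two columns, at one full row plus one cell, and when v + 1 = n.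
balanced≺balanced : ∀ c n v s Q R → 1 ≤ c → c + 2 ≤ n → s ≤ c →
                    suc c < v * suc c + s → v * suc c + s < n * suc c → R ≤ n → v * suc c + s ≡ Q * suc n + R →
                    balanced (suc c) v s ≺ balanced (suc n) Q R
balanced≺balanced 1 n (suc (suc v)) zero Q R _ c+2≤n s≤c _ up R≤n total =
  balanced∷≺balanced 1 n (suc (suc v)) 0 Q R (<⇒≤ (+2≤⇒< c+2≤n)) s≤c (quotient< _ 1 0 n up) R≤n total
    0 (suc (suc v)) (quotient< _ 1 0 n up) (trans (+-identityʳ _) (*-identityʳ _)) (inj₂ (s≤s z≤n , s≤s (s≤s z≤n)))
balanced≺balanced 1 n (suc v) 1 Q R _ c+2≤n s≤c _ up R≤n total =
  balanced∷≺balanced 1 n (suc v) 1 Q R (<⇒≤ (+2≤⇒< c+2≤n)) s≤c (quotient< _ 1 1 n up) R≤n total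
    0 (suc v) (quotient< _ 1 1 n up) (trans (+-identityʳ _) (*-identityʳ _)) (inj₂ (s≤s z≤n , s≤s (s≤s z≤n)))
balanced≺balanced 1 n 0 0 Q R _ _ _ () _ _ _
balanced≺balanced 1 n 1 0 Q R _ _ _ (s≤s (s≤s ())) _ _ _
balanced≺balanced 1 n 0 1 Q R _ _ _ (s≤s ()) _ _ _
balanced≺balanced 1 n v (suc (suc s)) Q R _ _ (s≤s ()) _ _ _ _
balanced≺balanced (suc (suc c)) n 0 s Q R _ _ s≤c lo _ _ _ = ⊥-elim (<⇒≱ lo (m≤n⇒m≤1+n s≤c))
balanced≺balanced (suc (suc c)) n 1 0 Q R _ _ _ lo _ _ _ =
  ⊥-elim (<-irrefl (sym (trans (+-identityʳ _) (+-identityʳ _))) lo)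
balanced≺balanced (suc (suc c)) n 1 1 Q R _ c+2≤n s≤c _ up R≤n total =
  balanced∷≺balanced (suc (suc c)) n 1 1 Q R (<⇒≤ (+2≤⇒< c+2≤n)) s≤c (quotient< 1 _ 1 n up) R≤n total
    0 (suc (suc c)) (+2≤⇒< c+2≤n) (trans (+-identityʳ _) (+-identityʳ _)) (inj₂ (s≤s z≤n , s≤s (s≤s z≤n)))
balanced≺balanced (suc (suc c)) (suc n) 1 (suc (suc s)) Q R _ (s≤s c+2≤n) s≤c lo up R≤n total
  with divMod (1 * suc (suc c) + suc s) n
... | q , r , r<n , tail-total =
  balanced∷≺balanced (suc (suc c)) (suc n) 1 (suc (suc s)) Q R (<⇒≤ (+2≤⇒< (s≤s c+2≤n))) s≤c
    (quotient< 1 _ _ (suc n) up) R≤n total q r r<n tail-total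
    (inj₁ (balanced≺balanced (suc c) n 1 (suc s) q r (s≤s z≤n) c+2≤n (≤-pred s≤c)
             (<1*+ (suc (suc c)) (suc s) (s≤s z≤n))
             (remainder-bound 1 _ _ n s≤c (≤-trans (m≤n+m 2 (suc c)) c+2≤n)) (≤-pred r<n) tail-total))
balanced≺balanced (suc (suc c)) zero (suc (suc v)) s Q R _ () _ _ _ _ _
balanced≺balanced (suc (suc c)) (suc n) (suc (suc v)) s Q R _ c+2≤n s≤c lo up R≤n total
  with m≤n⇒m<n∨m≡n (quotient< (suc (suc v)) _ s (suc n) up) | divMod (suc (suc v) * suc (suc c) + (s ∸ 1)) n
... | inj₁ (s≤s v+3≤n) | q , r , r<n , tail-total =
  balanced∷≺balanced (suc (suc c)) (suc n) (suc (suc v)) s Q R (<⇒≤ (+2≤⇒< c+2≤n)) s≤c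
    (quotient< (suc (suc v)) _ s (suc n) up) R≤n total q r r<n tail-total
    (inj₁ (balanced≺balanced (suc c) n (suc (suc v)) (s ∸ 1) q r (s≤s z≤n) (≤-pred c+2≤n) (pred≤ s≤c)
             (<2*+ (suc (suc c)) v (s ∸ 1) (s≤s z≤n))
             (remainder-bound (suc (suc v)) _ _ n (pred< (s≤s z≤n) s≤c) v+3≤n) (≤-pred r<n) tail-total))
... | inj₂ refl | _ with m≤n⇒∃[o]m+o≡n (≤-pred (≤-trans (≤-reflexive (+-comm 2 c)) (≤-pred (≤-pred c+2≤n))))
...   | e , refl =
  balanced∷≺balanced (suc (suc c)) _ _ s Q R (<⇒≤ (+2≤⇒< c+2≤n)) s≤c
    (quotient< _ (suc (suc c)) s _ up) R≤n total (suc c) (2 + e + (s ∸ 1)) r<n (regroup c e (s ∸ 1))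
    (inj₂ (s≤s z≤n , ≤-trans (s≤s (s≤s (s≤s (m≤m+n c e)))) (≤lead s _)))
  where
  regroup : ∀ c e x → suc (suc (suc c + e)) * suc (suc c) + x ≡ suc c * suc (suc (suc (suc c + e))) + (2 + e + x)
  regroup = solve-∀
  r<n : 2 + e + (s ∸ 1) < suc (suc (suc (suc c + e)))
  r<n = ≤-trans (+-monoʳ-< (2 + e) (pred< (s≤s z≤n) s≤c)) (≤-reflexive (columns c e))
    where
    columns : ∀ c e → 2 + e + suc (suc c) ≡ suc (suc (suc (suc c + e)))
    columns = solve-∀

-- Abel summation

#≥ : ℕ → List ℕ → ℕ
#≥ t []       = 0
#≥ t (x ∷ xs) with t ≤? x
... | yes _ = suc (#≥ t xs)
... | no  _ = #≥ t xs

#≥-++ : ∀ t xs ys → #≥ t (xs ++ ys) ≡ #≥ t xs + #≥ t ys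
#≥-++ t []       ys = refl
#≥-++ t (x ∷ xs) ys with t ≤? x
... | yes _ = cong suc (#≥-++ t xs ys)
... | no  _ = #≥-++ t xs ys

#≥-0 : ∀ zs → #≥ 0 zs ≡ length zs
#≥-0 []       = refl
#≥-0 (z ∷ zs) = cong suc (#≥-0 zs)

sumBy : (ℕ → ℚ) → List ℕ → ℚ
sumBy ω []       = 0ℚ
sumBy ω (x ∷ xs) = ω x ℚ.+ sumBy ω xs

sumBy-++ : ∀ ω xs ys → sumBy ω (xs ++ ys) ≡ sumBy ω xs ℚ.+ sumBy ω ys
sumBy-++ ω []       ys = sym (ℚ.+-identityˡ _)
sumBy-++ ω (x ∷ xs) ys = trans (cong (ω x ℚ.+_) (sumBy-++ ω xs ys)) (sym (ℚ.+-assoc (ω x) _ _))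

infixr 8 _·_

_·_ : ℕ → ℚ → ℚ
zero  · d = 0ℚ
suc k · d = d ℚ.+ k · d

·-monoˡ-≤ : ∀ {k k′} d → 0ℚ ℚ.≤ d → k ≤ k′ → k · d ℚ.≤ k′ · d
·-monoˡ-≤ {zero}  {zero}   d 0≤d _         = ℚ.≤-refl
·-monoˡ-≤ {zero}  {suc k′} d 0≤d _         =
  ℚ.≤-trans (ℚ.≤-reflexive (sym (ℚ.+-identityˡ 0ℚ))) (ℚ.+-mono-≤ 0≤d (·-monoˡ-≤ {zero} {k′} d 0≤d z≤n))
·-monoˡ-≤ {suc k} {suc k′} d 0≤d (s≤s k≤k′) = ℚ.+-monoʳ-≤ d (·-monoˡ-≤ d 0≤d k≤k′)

·-monoˡ-< : ∀ {k k′} d → 0ℚ ℚ.< d → k < k′ → k · d ℚ.< k′ · d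
·-monoˡ-< {zero}  {suc k′} d 0<d _           =
  ℚ.<-≤-trans (ℚ.≤-<-trans (ℚ.≤-reflexive (sym (ℚ.+-identityʳ 0ℚ))) (ℚ.+-mono-<-≤ 0<d ℚ.≤-refl))
              (ℚ.+-monoʳ-≤ d (·-monoˡ-≤ {zero} {k′} d (ℚ.<⇒≤ 0<d) z≤n))
·-monoˡ-< {suc k} {suc k′} d 0<d (s≤s k<k′) = ℚ.+-monoʳ-< d (·-monoˡ-< d 0<d k<k′)

-- Truncating every entry at R and raising R one step at a time adds ω (R + 1) - ω R once for each
-- entry ≥ R + 1.
module AbelSummation (ω : ℕ → ℚ) where

  capped : ℕ → List ℕ → ℚ
  capped R = sumBy (λ z → ω (z ⊓ R))

  δ : ℕ → ℚ
  δ R = ω (suc R) ℚ.- ω R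

  ω+δ : ∀ R → ω R ℚ.+ δ R ≡ ω (suc R)
  ω+δ R = lemma (ω R) (ω (suc R))
    where
    open +-*-Solver
    lemma : ∀ a b → a ℚ.+ (b ℚ.- a) ≡ b
    lemma = solve 2 (λ a b → a :+ (b :- a) := b) refl

  capped-0 : ∀ zs → capped 0 zs ≡ length zs · ω 0
  capped-0 []       = refl
  capped-0 (z ∷ zs) = cong₂ ℚ._+_ (cong ω (⊓-zeroʳ z)) (capped-0 zs)

  capped-suc : ∀ R zs → capped (suc R) zs ≡ capped R zs ℚ.+ #≥ (suc R) zs · δ R
  capped-suc R []       = sym (ℚ.+-identityʳ 0ℚ)
  capped-suc R (z ∷ zs) with suc R ≤? z
  ... | yes R<z = begin
    ω (z ⊓ suc R) ℚ.+ capped (suc R) zs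
      ≡⟨ cong₂ ℚ._+_ (trans (cong ω (m≥n⇒m⊓n≡n R<z)) (sym (ω+δ R))) (capped-suc R zs) ⟩
    (ω R ℚ.+ δ R) ℚ.+ (capped R zs ℚ.+ k · δ R)
      ≡⟨ interchange (ω R) (δ R) (capped R zs) (k · δ R) ⟩
    (ω R ℚ.+ capped R zs) ℚ.+ (δ R ℚ.+ k · δ R)
      ≡⟨ cong (λ x → (ω x ℚ.+ capped R zs) ℚ.+ (δ R ℚ.+ k · δ R)) (sym (m≥n⇒m⊓n≡n (<⇒≤ R<z))) ⟩
    (ω (z ⊓ R) ℚ.+ capped R zs) ℚ.+ (δ R ℚ.+ k · δ R) ∎
    where
    open ≡-Reasoning
    open +-*-Solver
    k = #≥ (suc R) zs
    interchange : ∀ a b c d → (a ℚ.+ b) ℚ.+ (c ℚ.+ d) ≡ (a ℚ.+ c) ℚ.+ (b ℚ.+ d)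
    interchange = solve 4 (λ a b c d → (a :+ b) :+ (c :+ d) := (a :+ c) :+ (b :+ d)) refl
  ... | no z≤R = begin
    ω (z ⊓ suc R) ℚ.+ capped (suc R) zs
      ≡⟨ cong₂ ℚ._+_ (cong ω (trans (m≤n⇒m⊓n≡m (m≤n⇒m≤1+n z≤R′)) (sym (m≤n⇒m⊓n≡m z≤R′)))) (capped-suc R zs) ⟩
    ω (z ⊓ R) ℚ.+ (capped R zs ℚ.+ #≥ (suc R) zs · δ R)
      ≡⟨ sym (ℚ.+-assoc (ω (z ⊓ R)) _ _) ⟩
    (ω (z ⊓ R) ℚ.+ capped R zs) ℚ.+ #≥ (suc R) zs · δ R ∎
    where
    open ≡-Reasoning
    z≤R′ : z ≤ R
    z≤R′ = ≤-pred (≰⇒> z≤R)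

  capped-large : ∀ R {zs} → All (_≤ R) zs → capped R zs ≡ sumBy ω zs
  capped-large R []               = refl
  capped-large R {z ∷ zs} (z≤R ∷ ps) = cong₂ ℚ._+_ (cong ω (m≤n⇒m⊓n≡m z≤R)) (capped-large R ps)

  module _ (xs ys : List ℕ) (same-length : length xs ≡ length ys) (fewer : ∀ t → #≥ t xs ≤ #≥ t ys) where

    capped-mono : (∀ r → ω r ℚ.≤ ω (suc r)) → ∀ R → capped R xs ℚ.≤ capped R ys
    capped-mono mono zero    =
      ℚ.≤-reflexive (trans (capped-0 xs) (trans (cong (_· ω 0) same-length) (sym (capped-0 ys))))
    capped-mono mono (suc R) = begin
      capped (suc R) xs                       ≡⟨ capped-suc R xs ⟩
      capped R xs ℚ.+ #≥ (suc R) xs · δ R     ≤⟨ ℚ.+-mono-≤ (capped-mono mono R) (·-monoˡ-≤ (δ R) (δ≥0 R) (fewer (suc R))) ⟩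
      capped R ys ℚ.+ #≥ (suc R) ys · δ R     ≡⟨ sym (capped-suc R ys) ⟩
      capped (suc R) ys                       ∎
      where
      open ℚ.≤-Reasoning
      δ≥0 : ∀ R → 0ℚ ℚ.≤ δ R
      δ≥0 R = ℚ.≤-trans (ℚ.≤-reflexive (sym (ℚ.+-inverseʳ (ω R)))) (ℚ.+-monoˡ-≤ (ℚ.- ω R) (mono R))

    capped-mono-strict : (∀ r → ω r ℚ.< ω (suc r)) → ∀ t → #≥ t xs < #≥ t ys → ∀ R → t ≤ R → capped R xs ℚ.< capped R ys
    capped-mono-strict smono zero    lt R _ = ⊥-elim (<-irrefl (trans (#≥-0 xs) (trans same-length (sym (#≥-0 ys)))) lt)
    capped-mono-strict smono (suc t) lt (suc R) (s≤s t≤R) = begin-strict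
      capped (suc R) xs                       ≡⟨ capped-suc R xs ⟩
      capped R xs ℚ.+ #≥ (suc R) xs · δ R     <⟨ step (m≤n⇒m<n∨m≡n t≤R) ⟩
      capped R ys ℚ.+ #≥ (suc R) ys · δ R     ≡⟨ sym (capped-suc R ys) ⟩
      capped (suc R) ys                       ∎
      where
      open ℚ.≤-Reasoning
      δ>0 : 0ℚ ℚ.< δ R
      δ>0 = ℚ.≤-<-trans (ℚ.≤-reflexive (sym (ℚ.+-inverseʳ (ω R)))) (ℚ.+-monoˡ-< (ℚ.- ω R) (smono R))
      step : t < R ⊎ t ≡ R → capped R xs ℚ.+ #≥ (suc R) xs · δ R ℚ.< capped R ys ℚ.+ #≥ (suc R) ys · δ R
      step (inj₁ t<R) = ℚ.+-mono-<-≤ (capped-mono-strict smono (suc t) lt R t<R)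
                                     (·-monoˡ-≤ (δ R) (ℚ.<⇒≤ δ>0) (fewer (suc R)))
      step (inj₂ refl) = ℚ.+-mono-≤-< (capped-mono (λ r → ℚ.<⇒≤ (smono r)) R) (·-monoˡ-< (δ R) δ>0 lt)

module _ (ω : ℕ → ℚ) (xs ys : List ℕ) (same-length : length xs ≡ length ys) (fewer : ∀ t → #≥ t xs ≤ #≥ t ys) where
  open AbelSummation ω

  sumBy-mono : (∀ r → ω r ℚ.≤ ω (suc r)) → sumBy ω xs ℚ.≤ sumBy ω ys
  sumBy-mono mono = begin
    sumBy ω xs      ≡⟨ sym (capped-large R (All.++⁻ˡ xs (xs≤max 0 (xs ++ ys)))) ⟩
    capped R xs     ≤⟨ capped-mono xs ys same-length fewer mono R ⟩
    capped R ys     ≡⟨ capped-large R (All.++⁻ʳ xs (xs≤max 0 (xs ++ ys))) ⟩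
    sumBy ω ys      ∎
    where
    open ℚ.≤-Reasoning
    R = max 0 (xs ++ ys)

  sumBy-mono-strict : (∀ r → ω r ℚ.< ω (suc r)) → ∀ t → #≥ t xs < #≥ t ys → sumBy ω xs ℚ.< sumBy ω ys
  sumBy-mono-strict smono t lt = begin-strict
    sumBy ω xs      ≡⟨ sym (capped-large R (All.++⁻ˡ xs (xs≤max t (xs ++ ys)))) ⟩
    capped R xs     <⟨ capped-mono-strict xs ys same-length fewer smono t lt R (⊥≤max t (xs ++ ys)) ⟩
    capped R ys     ≡⟨ capped-large R (All.++⁻ʳ xs (xs≤max t (xs ++ ys))) ⟩
    sumBy ω ys      ∎
    where
    open ℚ.≤-Reasoning
    R = max t (xs ++ ys)

columnRanks : ℕ → ℕ → List ℕ
columnRanks o zero    = []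
columnRanks o (suc h) = o ∷ columnRanks (suc o) h

diagramRanks : ℕ → List ℕ → List ℕ
diagramRanks o []       = []
diagramRanks o (h ∷ hs) = columnRanks o h ++ diagramRanks (suc o) hs

#≥-columnRanks : ∀ t o h → #≥ t (columnRanks o h) ≡ h ∸ (t ∸ o)
#≥-columnRanks t o zero    = sym (0∸n≡0 (t ∸ o))
#≥-columnRanks t o (suc h) with t ≤? o
... | yes t≤o rewrite #≥-columnRanks t (suc o) h | m≤n⇒m∸n≡0 t≤o | m≤n⇒m∸n≡0 (m≤n⇒m≤1+n t≤o) = refl
... | no t≰o with ≰⇒> t≰o
...   | s≤s {n = t′} o≤t′ rewrite #≥-columnRanks (suc t′) (suc o) h | +-∸-assoc 1 o≤t′ = refl

#≥-diagramRanks : ∀ t o hs → #≥ t (diagramRanks o hs) ≡ cells≥ (t ∸ o) hs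
#≥-diagramRanks t o []       = refl
#≥-diagramRanks t o (h ∷ hs) = begin
  #≥ t (columnRanks o h ++ diagramRanks (suc o) hs)
    ≡⟨ #≥-++ t (columnRanks o h) _ ⟩
  #≥ t (columnRanks o h) + #≥ t (diagramRanks (suc o) hs)
    ≡⟨ cong₂ _+_ (#≥-columnRanks t o h) (#≥-diagramRanks t (suc o) hs) ⟩
  (h ∸ (t ∸ o)) + cells≥ (t ∸ suc o) hs
    ≡⟨ cong (λ u → (h ∸ (t ∸ o)) + cells≥ u hs) (trans (cong (t ∸_) (+-comm 1 o)) (sym (∸-+-assoc t o 1))) ⟩
  (h ∸ (t ∸ o)) + cells≥ (t ∸ o ∸ 1) hs ∎
  where open ≡-Reasoning

length-diagramRanks : ∀ o hs → length (diagramRanks o hs) ≡ sum hs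
length-diagramRanks o []       = refl
length-diagramRanks o (h ∷ hs) =
  trans (length-++ (columnRanks o h)) (cong₂ _+_ (length-columnRanks o h) (length-diagramRanks (suc o) hs))
  where
  length-columnRanks : ∀ o h → length (columnRanks o h) ≡ h
  length-columnRanks o zero    = refl
  length-columnRanks o (suc h) = cong suc (length-columnRanks (suc o) h)

module _ (ω : ℕ → ℚ) (hs ks : List ℕ) (same-size : sum hs ≡ sum ks) (hs≼ks : hs ≼ ks) where

  private
    same-length : length (diagramRanks 0 hs) ≡ length (diagramRanks 0 ks)
    same-length = trans (length-diagramRanks 0 hs) (trans same-size (sym (length-diagramRanks 0 ks)))

    fewer : ∀ t → #≥ t (diagramRanks 0 hs) ≤ #≥ t (diagramRanks 0 ks)
    fewer t = subst₂ _≤_ (sym (#≥-diagramRanks t 0 hs)) (sym (#≥-diagramRanks t 0 ks)) (hs≼ks t)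

  diagramWeight-mono : (∀ r → ω r ℚ.≤ ω (suc r)) → sumBy ω (diagramRanks 0 hs) ℚ.≤ sumBy ω (diagramRanks 0 ks)
  diagramWeight-mono = sumBy-mono ω (diagramRanks 0 hs) (diagramRanks 0 ks) same-length fewer

  diagramWeight-mono-strict : (∀ r → ω r ℚ.< ω (suc r)) → hs ≺ ks →
                              sumBy ω (diagramRanks 0 hs) ℚ.< sumBy ω (diagramRanks 0 ks)
  diagramWeight-mono-strict smono (t , lt) =
    sumBy-mono-strict ω (diagramRanks 0 hs) (diagramRanks 0 ks) same-length fewer smono t
      (subst₂ _<_ (sym (#≥-diagramRanks t 0 hs)) (sym (#≥-diagramRanks t 0 ks)) lt)

-- Downsets of the grid

height : ∀ {n} → (Fin n → Bool) → ℕ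
height {n} f = sumℕ n (λ b → if f b then 1 else 0)

heights : ∀ {c n} → Subset c n → List ℕ
heights {zero}  S = []
heights {suc c} S = height (S Fin.zero) ∷ heights (λ a → S (Fin.suc a))

size≡sum-heights : ∀ {c n} (S : Subset c n) → size S ≡ sum (heights S)
size≡sum-heights {zero}  S = refl
size≡sum-heights {suc c} S = cong (height (S Fin.zero) +_) (size≡sum-heights (λ a → S (Fin.suc a)))

length-heights : ∀ {c n} (S : Subset c n) → length (heights S) ≡ c
length-heights {zero}  S = refl
length-heights {suc c} S = cong suc (length-heights (λ a → S (Fin.suc a)))

heights-All : ∀ {c n} (P : ℕ → Set) (S : Subset c n) → (∀ a → P (height (S a))) → All P (heights S)
heights-All {zero}  P S h = []
heights-All {suc c} P S h = h Fin.zero ∷ heights-All P (λ a → S (Fin.suc a)) (λ a → h (Fin.suc a))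

DownwardClosed : ∀ {n} → (Fin n → Bool) → Set
DownwardClosed {n} f = ∀ (b d : Fin n) → f d ≡ true → toℕ b ≤ toℕ d → f b ≡ true

DownwardClosed-suc : ∀ {n} {f : Fin (suc n) → Bool} → DownwardClosed f → DownwardClosed (λ b → f (Fin.suc b))
DownwardClosed-suc dc b d fd b≤d = dc (Fin.suc b) (Fin.suc d) fd (s≤s b≤d)

Downset⇒DownwardClosed : ∀ {c n} {S : Subset c n} → Downset S → ∀ a → DownwardClosed (S a)
Downset⇒DownwardClosed D a b d Sad b≤d = D a b a d Sad ≤-refl b≤d

Downset-suc : ∀ {c n} {S : Subset (suc c) n} → Downset S → Downset (λ a → S (Fin.suc a))
Downset-suc D a b c d Scd a≤c b≤d = D (Fin.suc a) b (Fin.suc c) d Scd (s≤s a≤c) b≤d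

private
  true≢false : true ≢ false
  true≢false ()

column-empty : ∀ {n} (f : Fin (suc n) → Bool) → DownwardClosed f → f Fin.zero ≡ false → ∀ b → f b ≡ false
column-empty f dc f0 b with f b in fb
... | false = refl
... | true  = ⊥-elim (true≢false (trans (sym (dc Fin.zero b fb z≤n)) f0))

height-empty : ∀ {n} (f : Fin n → Bool) → (∀ b → f b ≡ false) → height f ≡ 0
height-empty {zero}  f empty = refl
height-empty {suc n} f empty rewrite empty Fin.zero = height-empty (λ b → f (Fin.suc b)) (λ b → empty (Fin.suc b))

member⇒<height : ∀ {n} (f : Fin n → Bool) → DownwardClosed f → ∀ b → f b ≡ true → toℕ b < height f
member⇒<height {suc n} f dc b fb with f Fin.zero in f0
... | false = ⊥-elim (true≢false (trans (sym fb) (column-empty f dc f0 b)))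
member⇒<height {suc n} f dc Fin.zero    fb | true = s≤s z≤n
member⇒<height {suc n} f dc (Fin.suc b) fb | true =
  s≤s (member⇒<height (λ b → f (Fin.suc b)) (DownwardClosed-suc dc) b fb)

<height⇒member : ∀ {n} (f : Fin n → Bool) → DownwardClosed f → ∀ b → toℕ b < height f → f b ≡ true
<height⇒member {suc n} f dc b b<h with f Fin.zero in f0
... | false = ⊥-elim (<⇒≱ b<h (subst (_≤ toℕ b) (sym (height-empty _ (λ b → column-empty f dc f0 (Fin.suc b)))) z≤n))
<height⇒member {suc n} f dc Fin.zero    _         | true = f0
<height⇒member {suc n} f dc (Fin.suc b) (s≤s b<h) | true = <height⇒member (λ b → f (Fin.suc b)) (DownwardClosed-suc dc) b b<h

≮height⇒nonmember : ∀ {n} (f : Fin n → Bool) → DownwardClosed f → ∀ b → ¬ toℕ b < height f → f b ≡ false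
≮height⇒nonmember f dc b b≮h with f b in fb
... | false = refl
... | true  = ⊥-elim (b≮h (member⇒<height f dc b fb))

height≤ : ∀ {n} (f : Fin n → Bool) → height f ≤ n
height≤ {zero}  f = z≤n
height≤ {suc n} f with f Fin.zero
... | true  = s≤s (height≤ (λ b → f (Fin.suc b)))
... | false = m≤n⇒m≤1+n (height≤ (λ b → f (Fin.suc b)))

height-mono : ∀ {n} (f g : Fin n → Bool) → (∀ b → g b ≡ true → f b ≡ true) → height g ≤ height f
height-mono {zero}  f g g⊆f = z≤n
height-mono {suc n} f g g⊆f with g Fin.zero in g0 | f Fin.zero in f0
... | true  | true  = s≤s (height-mono _ _ (λ b → g⊆f (Fin.suc b)))
... | true  | false = ⊥-elim (true≢false (trans (sym (g⊆f Fin.zero g0)) f0))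
... | false | true  = m≤n⇒m≤1+n (height-mono _ _ (λ b → g⊆f (Fin.suc b)))
... | false | false = height-mono _ _ (λ b → g⊆f (Fin.suc b))

NonIncreasing-heights : ∀ {c n} (S : Subset c n) → Downset S → NonIncreasing (heights S)
NonIncreasing-heights {zero}  S D = []
NonIncreasing-heights {suc c} S D =
  heights-All (_≤ height (S Fin.zero)) _
    (λ a → height-mono (S Fin.zero) (S (Fin.suc a)) (λ b Sab → D Fin.zero b (Fin.suc a) b Sab z≤n ≤-refl))
  ∷ NonIncreasing-heights _ (Downset-suc D)

heights≤ : ∀ {c n} (S : Subset c n) → All (_≤ n) (heights S)
heights≤ S = heights-All _ S (λ a → height≤ (S a))

sumℚ-cong : ∀ n {f g : Fin n → ℚ} → (∀ i → f i ≡ g i) → sumℚ n f ≡ sumℚ n g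
sumℚ-cong zero    f≗g = refl
sumℚ-cong (suc n) f≗g = cong₂ ℚ._+_ (f≗g Fin.zero) (sumℚ-cong n (λ i → f≗g (Fin.suc i)))

sumℚ-empty : ∀ n (f : Fin n → Bool) (g : Fin n → ℚ) → (∀ b → f b ≡ false) →
             sumℚ n (λ b → if f b then g b else 0ℚ) ≡ 0ℚ
sumℚ-empty zero    f g empty = refl
sumℚ-empty (suc n) f g empty rewrite empty Fin.zero =
  trans (ℚ.+-identityˡ _) (sumℚ-empty n (λ b → f (Fin.suc b)) (λ b → g (Fin.suc b)) (λ b → empty (Fin.suc b)))

columnWeight : ∀ {n} (ω : ℕ → ℚ) (f : Fin n → Bool) o → DownwardClosed f →
               sumℚ n (λ b → if f b then ω (o + toℕ b) else 0ℚ) ≡ sumBy ω (columnRanks o (height f))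
columnWeight {zero}  ω f o dc = refl
columnWeight {suc n} ω f o dc with f Fin.zero in f0
... | false = begin
  0ℚ ℚ.+ sumℚ n (λ b → if f (Fin.suc b) then ω (o + suc (toℕ b)) else 0ℚ)
    ≡⟨ ℚ.+-identityˡ _ ⟩
  sumℚ n (λ b → if f (Fin.suc b) then ω (o + suc (toℕ b)) else 0ℚ)
    ≡⟨ sumℚ-empty n _ _ empty ⟩
  0ℚ
    ≡⟨ cong (λ h → sumBy ω (columnRanks o h)) (sym (height-empty _ empty)) ⟩
  sumBy ω (columnRanks o (height (λ b → f (Fin.suc b)))) ∎
  where
  open ≡-Reasoning
  empty : ∀ b → f (Fin.suc b) ≡ false
  empty b = column-empty f dc f0 (Fin.suc b)
... | true = cong₂ ℚ._+_ (cong ω (+-identityʳ o)) (begin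
  sumℚ n (λ b → if f (Fin.suc b) then ω (o + suc (toℕ b)) else 0ℚ)
    ≡⟨ sumℚ-cong n (λ b → cong (λ x → if f (Fin.suc b) then ω x else 0ℚ) (+-suc o (toℕ b))) ⟩
  sumℚ n (λ b → if f (Fin.suc b) then ω (suc o + toℕ b) else 0ℚ)
    ≡⟨ columnWeight ω (λ b → f (Fin.suc b)) (suc o) (DownwardClosed-suc dc) ⟩
  sumBy ω (columnRanks (suc o) (height (λ b → f (Fin.suc b)))) ∎)
  where open ≡-Reasoning

gridWeight : ∀ {c n} (ω : ℕ → ℚ) (S : Subset c n) o → (∀ a → DownwardClosed (S a)) →
             sumℚ c (λ a → sumℚ n (λ b → if S a b then ω (o + toℕ a + toℕ b) else 0ℚ)) ≡ sumBy ω (diagramRanks o (heights S))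
gridWeight {zero}      ω S o dc = refl
gridWeight {suc c} {n} ω S o dc = begin
  sumℚ n (λ b → if S Fin.zero b then ω (o + 0 + toℕ b) else 0ℚ) ℚ.+
  sumℚ c (λ a → sumℚ n (λ b → if S (Fin.suc a) b then ω (o + suc (toℕ a) + toℕ b) else 0ℚ))
    ≡⟨ cong₂ ℚ._+_ (trans (sumℚ-cong n (λ b → cong (λ x → if S Fin.zero b then ω (x + toℕ b) else 0ℚ) (+-identityʳ o)))
                          (columnWeight ω (S Fin.zero) o (dc Fin.zero)))
                   (trans (sumℚ-cong c (λ a → sumℚ-cong n (λ b →
                             cong (λ x → if S (Fin.suc a) b then ω (x + toℕ b) else 0ℚ) (+-suc o (toℕ a)))))
                          (gridWeight ω (λ a → S (Fin.suc a)) (suc o) (λ a → dc (Fin.suc a)))) ⟩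
  sumBy ω (columnRanks o (height (S Fin.zero))) ℚ.+ sumBy ω (diagramRanks (suc o) (heights (λ a → S (Fin.suc a))))
    ≡⟨ sym (sumBy-++ ω (columnRanks o (height (S Fin.zero))) _) ⟩
  sumBy ω (diagramRanks o (heights S)) ∎
  where open ≡-Reasoning

weight≡sumBy : ∀ {c n} (ω : ℕ → ℚ) (wt : Weight c n) → (∀ a b → wt a b ≡ ω (rank a b)) →
               (S : Subset c n) → Downset S → weight wt S ≡ sumBy ω (diagramRanks 0 (heights S))
weight≡sumBy {c} {n} ω wt wt≡ω S D = trans
  (sumℚ-cong c (λ a → sumℚ-cong n (λ b → cong (λ x → if S a b then x else 0ℚ) (wt≡ω a b))))
  (gridWeight ω S 0 (Downset⇒DownwardClosed D))

-- ω r is the weight of the cells of rank r; past the top rank c + n it keeps growing by 1, which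
-- makes it strictly increasing on all of ℕ.
module RankWeight {c n} (wt : Weight (suc c) (suc n)) (increasing : RankIncreasing wt) (constant : RankConstant wt) where

  private
    top = c + n

    cap : ℕ → ℕ
    cap r = r ⊓ top

    column : ℕ → Fin (suc c)
    column r = Fin.fromℕ< (s≤s (m⊓n≤n (cap r) c))

    row-bound : ∀ r → cap r ∸ c < suc n
    row-bound r = s≤s (≤-trans (∸-monoˡ-≤ c (m⊓n≤n r top)) (≤-reflexive (m+n∸m≡n c n)))

    row : ℕ → Fin (suc n)
    row r = Fin.fromℕ< (row-bound r)

    rank-cell : ∀ r → rank (column r) (row r) ≡ cap r
    rank-cell r = trans (cong₂ _+_ (toℕ-fromℕ< (s≤s (m⊓n≤n (cap r) c))) (toℕ-fromℕ< (row-bound r)))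
                        (trans (cong (_+ (cap r ∸ c)) (⊓-comm (cap r) c)) (m⊓n+n∸m≡n c (cap r)))

    rank≤top : ∀ a b → rank {suc c} {suc n} a b ≤ top
    rank≤top a b = +-mono-≤ (≤-pred (toℕ<n a)) (≤-pred (toℕ<n b))

  ω : ℕ → ℚ
  ω r = wt (column r) (row r) ℚ.+ (r ∸ top) · 1ℚ

  wt≡ω : ∀ a b → wt a b ≡ ω (rank a b)
  wt≡ω a b = begin
    wt a b                                        ≡⟨ constant a b (column r) (row r) (sym (trans (rank-cell r) (m≤n⇒m⊓n≡m r≤top))) ⟩
    wt (column r) (row r)                         ≡⟨ sym (ℚ.+-identityʳ _) ⟩
    wt (column r) (row r) ℚ.+ 0 · 1ℚ               ≡⟨ cong (λ k → wt (column r) (row r) ℚ.+ k · 1ℚ) (sym (m≤n⇒m∸n≡0 r≤top)) ⟩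
    ω r                                           ∎
    where
    open ≡-Reasoning
    r = rank a b
    r≤top = rank≤top a b

  ω-increasing : ∀ r → ω r ℚ.< ω (suc r)
  ω-increasing r with r <? top
  ... | yes r<top rewrite m≤n⇒m∸n≡0 (<⇒≤ r<top) | m≤n⇒m∸n≡0 r<top =
    ℚ.+-monoˡ-< 0ℚ (increasing (column r) (row r) (column (suc r)) (row (suc r))
      (subst₂ _<_ (sym (trans (rank-cell r) (m≤n⇒m⊓n≡m (<⇒≤ r<top))))
                  (sym (trans (rank-cell (suc r)) (m≤n⇒m⊓n≡m r<top))) (n<1+n r)))
  ... | no r≮top = begin-strict
    wt (column r) (row r) ℚ.+ (r ∸ top) · 1ℚ
      ≡⟨ cong (ℚ._+ (r ∸ top) · 1ℚ) same-cell ⟩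
    wt (column (suc r)) (row (suc r)) ℚ.+ (r ∸ top) · 1ℚ
      <⟨ ℚ.+-monoʳ-< (wt (column (suc r)) (row (suc r))) (·-monoˡ-< 1ℚ (ℚ.positive⁻¹ 1ℚ) (n<1+n (r ∸ top))) ⟩
    wt (column (suc r)) (row (suc r)) ℚ.+ suc (r ∸ top) · 1ℚ
      ≡⟨ cong (λ k → wt (column (suc r)) (row (suc r)) ℚ.+ k · 1ℚ) (sym (+-∸-assoc 1 top≤r)) ⟩
    ω (suc r) ∎
    where
    open ℚ.≤-Reasoning
    top≤r : top ≤ r
    top≤r = ≮⇒≥ r≮top
    same-cell : wt (column r) (row r) ≡ wt (column (suc r)) (row (suc r))
    same-cell = constant _ _ _ _ (trans (rank-cell r) (trans (m≥n⇒m⊓n≡n top≤r)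
                                   (sym (trans (rank-cell (suc r)) (m≥n⇒m⊓n≡n (m≤n⇒m≤1+n top≤r))))))

  ω-monotone : ∀ r → ω r ℚ.≤ ω (suc r)
  ω-monotone r = ℚ.<⇒≤ (ω-increasing r)

-- Initial segments

data LShaped (n : ℕ) : List ℕ → Set where
  []      : LShaped n []
  full    : ∀ {hs} → LShaped n hs → LShaped n (n ∷ hs)
  partial : ∀ {h hs} → h < n → All (_≤ 0) hs → LShaped n (h ∷ hs)

IsInitialSegment-suc : ∀ {c n} {S : Subset (suc c) n} → IsInitialSegment _<L_ S → IsInitialSegment _<L_ (λ a → S (Fin.suc a))
IsInitialSegment-suc init (a , b) (a′ , b′) x∈S y∉S with init (Fin.suc a , b) (Fin.suc a′ , b′) x∈S y∉S
... | inj₁ a<a′          = inj₁ (≤-pred a<a′)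
... | inj₂ (a≡a′ , b<b′) = inj₂ (suc-injective a≡a′ , b<b′)

-- If the first column has a gap, a cell of a later column would have to precede it lexicographically.
LShaped-heights : ∀ {c n} (S : Subset c n) → Downset S → IsInitialSegment _<L_ S → LShaped n (heights S)
LShaped-heights {zero}      S D init = []
LShaped-heights {suc c} {n} S D init with m≤n⇒m<n∨m≡n (height≤ (S Fin.zero))
... | inj₂ full-column rewrite full-column =
  full (LShaped-heights (λ a → S (Fin.suc a)) (Downset-suc D) (IsInitialSegment-suc init))
... | inj₁ h<n = partial h<n (heights-All (_≤ 0) _ (λ a → ≤-reflexive (empty a)))
  where
  gap : Fin n
  gap = Fin.fromℕ< h<n
  gap∉S : S Fin.zero gap ≡ false
  gap∉S = ≮height⇒nonmember (S Fin.zero) (Downset⇒DownwardClosed D Fin.zero) gap (<-irrefl (toℕ-fromℕ< h<n))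
  empty : ∀ a → height (S (Fin.suc a)) ≡ 0
  empty a with height (S (Fin.suc a)) in h≡
  ... | zero  = refl
  ... | suc _ = ⊥-elim (not-before (init (Fin.suc a , bottom) (Fin.zero , gap) bottom∈S gap∉S))
    where
    bottom : Fin n
    bottom = Fin.fromℕ< (≤-<-trans z≤n h<n)
    bottom∈S : S (Fin.suc a) bottom ≡ true
    bottom∈S = <height⇒member (S (Fin.suc a)) (Downset⇒DownwardClosed D (Fin.suc a)) bottom
                 (subst₂ _<_ (sym (toℕ-fromℕ< (≤-<-trans z≤n h<n))) (sym h≡) (s≤s z≤n))
    not-before : ¬ (Fin.suc a , bottom) <L (Fin.zero , gap)
    not-before (inj₁ ())
    not-before (inj₂ (() , _))

LShaped⇒≃balanced : ∀ {n hs} → 1 ≤ n → LShaped n hs →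
                    ∃[ Q ] ∃[ R ] (R < n × sum hs ≡ Q * n + R × balanced n Q R ≃ hs)
LShaped⇒≃balanced {n} 1≤n [] = 0 , 0 , 1≤n , refl , λ t → trans (cells≥-balanced₀ t n 0) (0∸n≡0 t)
LShaped⇒≃balanced {n} 1≤n (full shape) with LShaped⇒≃balanced 1≤n shape
... | Q , R , R<n , sum≡ , bal≃ = suc Q , R , R<n , trans (cong (n +_) sum≡) (sym (+-assoc n (Q * n) R)) ,
  λ t → trans (cells≥-balanced-suc t Q (<⇒≤ R<n)) (cong ((n ∸ t) +_) (bal≃ (t ∸ 1)))
LShaped⇒≃balanced {n} 1≤n (partial {h} {hs} h<n zeros) = 0 , h , h<n ,
  trans (cong (h +_) (trans (sym (cells≥-0 hs)) (cells≥-zeros 0 zeros))) (+-identityʳ h) ,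
  λ t → trans (cells≥-balanced₀ t n h)
              (sym (trans (cong ((h ∸ t) +_) (cells≥-zeros (t ∸ 1) zeros)) (+-identityʳ _)))

nearlyConstant⇒balanced : ∀ x xs → NonIncreasing (x ∷ xs) → All (λ y → x ≤ suc y) xs →
                          ∃[ v ] ∃[ s ] (s < suc (length xs) × x ∷ xs ≡ balanced (suc (length xs)) v s)
nearlyConstant⇒balanced x []       _                   _                  = x , 0 , s≤s z≤n , refl
nearlyConstant⇒balanced x (y ∷ ys) ((y≤x ∷ _) ∷ ni) (x≤1+y ∷ x≤1+ys)
  with nearlyConstant⇒balanced y ys ni (All.map (≤-trans y≤x) x≤1+ys) | m≤n⇒m<n∨m≡n y≤x
... | v , zero  , _  , y∷ys≡ | inj₂ refl = v , 0 , s≤s z≤n , cong₂ _∷_ (∷-injectiveˡ y∷ys≡) y∷ys≡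
... | v , suc s , s< , y∷ys≡ | inj₂ refl = v , suc (suc s) , s≤s s< , cong₂ _∷_ (∷-injectiveˡ y∷ys≡) y∷ys≡
... | v , zero  , _  , y∷ys≡ | inj₁ y<x =
  v , 1 , s≤s (s≤s z≤n) , cong₂ _∷_ (trans (≤-antisym x≤1+y y<x) (cong suc (∷-injectiveˡ y∷ys≡))) y∷ys≡
... | v , suc s , s< , y∷ys≡ | inj₁ y<x = ⊥-elim (<-irrefl refl (≤-trans (s≤s (s≤s ≤-refl)) x≤1+v))
  where
  x≡ : x ≡ suc (suc v)
  x≡ = trans (≤-antisym x≤1+y y<x) (cong suc (∷-injectiveˡ y∷ys≡))
  x≤1+lows : All (λ z → x ≤ suc z) (replicate (length ys ∸ s) v)
  x≤1+lows = ++⁻ʳ (replicate s (suc v)) (subst (All (λ z → x ≤ suc z)) (∷-injectiveʳ y∷ys≡) x≤1+ys)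
  x≤1+v : suc (suc v) ≤ suc v
  x≤1+v with length ys ∸ s in k≡ | x≤1+lows
  ... | zero  | _ = ⊥-elim (<⇒≢ (m<n⇒0<n∸m (≤-pred s<)) (sym k≡))
  ... | suc _ | x≤ ∷ _ = subst (_≤ suc v) x≡ x≤

-- In a colexicographic initial segment no column is two cells higher than another.
balanced-heights : ∀ {c n} (S : Subset (suc c) n) → Downset S → IsInitialSegment _<C_ S →
                   ∃[ v ] ∃[ s ] (s < suc c × heights S ≡ balanced (suc c) v s)
balanced-heights {c} {n} S D init
  with nearlyConstant⇒balanced (height (S Fin.zero)) (heights (λ a → S (Fin.suc a)))
         (NonIncreasing-heights S D) (heights-All _ _ nearly)
  where
  nearly : ∀ a → height (S Fin.zero) ≤ suc (height (S (Fin.suc a)))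
  nearly a with height (S Fin.zero) ≤? suc (height (S (Fin.suc a)))
  ... | yes h≤ = h≤
  ... | no h≰ = ⊥-elim (not-before (init (Fin.zero , high) (Fin.suc a , low) high∈S low∉S))
    where
    h₀ = height (S Fin.zero)
    h₁ = height (S (Fin.suc a))
    gap : suc (suc h₁) ≤ h₀
    gap = ≰⇒> h≰
    high-bound : suc h₁ < n
    high-bound = ≤-trans gap (height≤ (S Fin.zero))
    high low : Fin n
    high = Fin.fromℕ< high-bound
    low  = Fin.fromℕ< (<-trans (n<1+n h₁) high-bound)
    high∈S : S Fin.zero high ≡ true
    high∈S = <height⇒member (S Fin.zero) (Downset⇒DownwardClosed D Fin.zero) high
               (subst (_< h₀) (sym (toℕ-fromℕ< high-bound)) gap)
    low∉S : S (Fin.suc a) low ≡ false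
    low∉S = ≮height⇒nonmember (S (Fin.suc a)) (Downset⇒DownwardClosed D (Fin.suc a)) low
              (<-irrefl (toℕ-fromℕ< _))
    not-before : ¬ (Fin.zero , high) <C (Fin.suc a , low)
    not-before (inj₁ lt) = <-asym (subst₂ _<_ (toℕ-fromℕ< high-bound) (toℕ-fromℕ< _) lt) (n<1+n h₁)
    not-before (inj₂ (eq , _)) = 1+n≢n (trans (sym (toℕ-fromℕ< high-bound)) (trans eq (toℕ-fromℕ< _)))
... | v , s , s< , hs≡ rewrite length-heights (λ a → S (Fin.suc a)) = v , s , s< , hs≡

private
  <ᵇ≡true : ∀ {m n} → m < n → (m <ᵇ n) ≡ true
  <ᵇ≡true {m} {n} m<n with m <ᵇ n | <⇒<ᵇ m<n
  ... | true | _ = refl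

  <ᵇ≡true⇒< : ∀ m n → (m <ᵇ n) ≡ true → m < n
  <ᵇ≡true⇒< m n eq = <ᵇ⇒< m n (subst T (sym eq) _)

  <ᵇ≡false⇒≥ : ∀ m n → (m <ᵇ n) ≡ false → n ≤ m
  <ᵇ≡false⇒≥ m n eq with m <? n
  ... | yes m<n = ⊥-elim (true≢false (trans (sym (<ᵇ≡true m<n)) eq))
  ... | no  m≮n = ≮⇒≥ m≮n

  ≮⇒<ᵇ≡false : ∀ {m n} → ¬ m < n → (m <ᵇ n) ≡ false
  ≮⇒<ᵇ≡false {m} {n} m≮n with m <ᵇ n in eq
  ... | false = refl
  ... | true  = ⊥-elim (m≮n (<ᵇ≡true⇒< m n eq))

-- The cell (a , b) is the (a n + b)-th element of the lexicographic order.
lexSegment : ∀ c n → ℕ → Subset c n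
lexSegment c n m a b = (toℕ a * n + toℕ b) <ᵇ m

Downset-lexSegment : ∀ c n m → Downset (lexSegment c n m)
Downset-lexSegment c n m a b a′ b′ a′b′∈ a≤a′ b≤b′ =
  <ᵇ≡true (≤-<-trans (+-mono-≤ (*-monoˡ-≤ n a≤a′) b≤b′) (<ᵇ≡true⇒< _ m a′b′∈))

IsInitialSegment-lexSegment : ∀ c n m → IsInitialSegment _<L_ (lexSegment c n m)
IsInitialSegment-lexSegment c n m (a , b) (a′ , b′) ab∈ a′b′∉ =
  lex (toℕ a) (toℕ b) (toℕ a′) (toℕ b′) (toℕ<n b) (toℕ<n b′)
      (<-≤-trans (<ᵇ≡true⇒< _ m ab∈) (<ᵇ≡false⇒≥ (toℕ a′ * n + toℕ b′) m a′b′∉))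
  where
  lex : ∀ a b a′ b′ → b < n → b′ < n → a * n + b < a′ * n + b′ → a < a′ ⊎ (a ≡ a′ × b < b′)
  lex a b a′ b′ b<n b′<n lt with <-cmp a a′
  ... | tri< a<a′ _ _ = inj₁ a<a′
  ... | tri≈ _ refl _ = inj₂ (refl , +-cancelˡ-< (a * n) b b′ lt)
  ... | tri> _ _ a>a′ = ⊥-elim (<⇒≱ lt (begin
    a′ * n + b′   ≤⟨ <⇒≤ (+-monoʳ-< (a′ * n) b′<n) ⟩
    a′ * n + n    ≡⟨ +-comm (a′ * n) n ⟩
    suc a′ * n    ≤⟨ *-monoˡ-≤ n a>a′ ⟩
    a * n         ≤⟨ m≤m+n (a * n) b ⟩
    a * n + b     ∎))
    where open ≤-Reasoning

sumℕ-cong : ∀ n {f g : Fin n → ℕ} → (∀ i → f i ≡ g i) → sumℕ n f ≡ sumℕ n g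
sumℕ-cong zero    f≗g = refl
sumℕ-cong (suc n) f≗g = cong₂ _+_ (f≗g Fin.zero) (sumℕ-cong n (λ i → f≗g (Fin.suc i)))

<ᵇ-shift : ∀ n y m → ((n + y) <ᵇ m) ≡ (y <ᵇ (m ∸ n))
<ᵇ-shift zero    y m       = refl
<ᵇ-shift (suc n) y zero    = refl
<ᵇ-shift (suc n) y (suc m) = <ᵇ-shift n y m

segmentColumn : ∀ n x m → sumℕ n (λ b → if (x + toℕ b) <ᵇ m then 1 else 0) ≡ (m ∸ x) ⊓ n
segmentColumn zero    x m = sym (⊓-zeroʳ (m ∸ x))
segmentColumn (suc n) x m
  rewrite sumℕ-cong n {λ b → if (x + suc (toℕ b)) <ᵇ m then 1 else 0} {λ b → if (suc x + toℕ b) <ᵇ m then 1 else 0}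
            (λ b → cong (λ z → if z <ᵇ m then 1 else 0) (+-suc x (toℕ b)))
        | segmentColumn n (suc x) m | +-identityʳ x with x <? m
... | yes x<m rewrite <ᵇ≡true x<m | +-∸-assoc 1 x<m = refl
... | no  x≮m rewrite ≮⇒<ᵇ≡false x≮m | m≤n⇒m∸n≡0 (≮⇒≥ x≮m) | m≤n⇒m∸n≡0 (m≤n⇒m≤1+n (≮⇒≥ x≮m)) = refl

size-lexSegment : ∀ c n m → m ≤ c * n → size (lexSegment c n m) ≡ m
size-lexSegment zero    n m m≤0 = sym (n≤0⇒n≡0 m≤0)
size-lexSegment (suc c) n m m≤ = begin
  sumℕ n (λ b → if toℕ b <ᵇ m then 1 else 0) +
    sumℕ c (λ a → sumℕ n (λ b → if ((n + toℕ a * n) + toℕ b) <ᵇ m then 1 else 0))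
    ≡⟨ cong₂ _+_ (segmentColumn n 0 m)
         (sumℕ-cong c (λ a → sumℕ-cong n (λ b →
            cong (λ z → if z then 1 else 0)
                 (trans (cong (_<ᵇ m) (+-assoc n (toℕ a * n) (toℕ b))) (<ᵇ-shift n (toℕ a * n + toℕ b) m))))) ⟩
  (m ⊓ n) + size (lexSegment c n (m ∸ n))
    ≡⟨ cong ((m ⊓ n) +_) (size-lexSegment c n (m ∸ n) (≤-trans (∸-monoˡ-≤ n m≤) (≤-reflexive (m+n∸m≡n n (c * n))))) ⟩
  (m ⊓ n) + (m ∸ n)
    ≡⟨ trans (cong (_+ (m ∸ n)) (⊓-comm m n)) (m⊓n+n∸m≡n n m) ⟩
  m ∎
  where open ≡-Reasoning

private
  cells≥-snoc : ∀ t xs x → cells≥ t (xs ++ [ x ]) ≡ cells≥ t xs + (x ∸ (t ∸ length xs))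
  cells≥-snoc t xs x = trans (cells≥-++ t xs [ x ]) (cong (cells≥ t xs +_) (+-identityʳ _))

  exchange : ∀ h j u → j < h → (suc h ∸ u) + ((h ∸ suc j) ∸ (u ∸ suc j)) ≡ (h ∸ u) + ((h ∸ j) ∸ (u ∸ suc j))
  exchange h       j       zero    j<h rewrite +-∸-assoc 1 j<h = sym (+-suc h (h ∸ suc j))
  exchange (suc h) zero    (suc u) _   = +-comm (suc h ∸ u) (h ∸ u)
  exchange (suc h) (suc j) (suc u) (s≤s j<h) = exchange h j u j<h

-- Moving the top j cells of the last column onto the first j columns preserves every rank.
full++short≃uniform : ∀ h j → j < h → replicate j (suc h) ++ [ h ∸ j ] ≃ replicate (suc j) h
full++short≃uniform h zero    _     u = refl
full++short≃uniform h (suc j) j+1<h u = begin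
  (suc h ∸ u) + cells≥ (u ∸ 1) (fulls ++ [ h ∸ suc j ])
    ≡⟨ cong ((suc h ∸ u) +_) (cells≥-snoc (u ∸ 1) fulls (h ∸ suc j)) ⟩
  (suc h ∸ u) + (F + ((h ∸ suc j) ∸ w))
    ≡⟨ shuffle (suc h ∸ u) F ((h ∸ suc j) ∸ w) ⟩
  F + ((suc h ∸ u) + ((h ∸ suc j) ∸ w))
    ≡⟨ cong (F +_) (subst (λ z → (suc h ∸ u) + ((h ∸ suc j) ∸ z) ≡ (h ∸ u) + ((h ∸ j) ∸ z)) (sym w≡)
                          (exchange h j u (<-trans (n<1+n j) j+1<h))) ⟩
  F + ((h ∸ u) + ((h ∸ j) ∸ w))
    ≡⟨ sym (shuffle (h ∸ u) F ((h ∸ j) ∸ w)) ⟩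
  (h ∸ u) + (F + ((h ∸ j) ∸ w))
    ≡⟨ cong ((h ∸ u) +_) (sym (cells≥-snoc (u ∸ 1) fulls (h ∸ j))) ⟩
  (h ∸ u) + cells≥ (u ∸ 1) (fulls ++ [ h ∸ j ])
    ≡⟨ cong ((h ∸ u) +_) (full++short≃uniform h j (<-trans (n<1+n j) j+1<h) (u ∸ 1)) ⟩
  (h ∸ u) + cells≥ (u ∸ 1) (replicate (suc j) h) ∎
  where
  open ≡-Reasoning
  fulls = replicate j (suc h)
  F = cells≥ (u ∸ 1) fulls
  w = (u ∸ 1) ∸ length fulls
  w≡ : w ≡ u ∸ suc j
  w≡ = trans (cong ((u ∸ 1) ∸_) (length-replicate j)) (∸-+-assoc u 1 j)
  shuffle : ∀ a b c → a + (b + c) ≡ b + (a + c)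
  shuffle = solve-∀

-- Optimality

AboveBalanced : ℕ → List ℕ → Set
AboveBalanced n hs = ∃[ Q ] ∃[ R ] (R < n × sum hs ≡ Q * n + R × balanced n Q R ≼ hs)

++⁺-≃ : ∀ xs {ys zs} → ys ≃ zs → xs ++ ys ≃ xs ++ zs
++⁺-≃ xs {ys} {zs} ys≃zs t = begin
  cells≥ t (xs ++ ys)                            ≡⟨ cells≥-++ t xs ys ⟩
  cells≥ t xs + cells≥ (t ∸ length xs) ys        ≡⟨ cong (cells≥ t xs +_) (ys≃zs (t ∸ length xs)) ⟩
  cells≥ t xs + cells≥ (t ∸ length xs) zs        ≡⟨ sym (cells≥-++ t xs zs) ⟩
  cells≥ t (xs ++ zs)                            ∎
  where open ≡-Reasoning

few-rows-above : ∀ {k N} v s → k < N → s < k → v * k + s ≤ k → AboveBalanced N (balanced k v s)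
few-rows-above {k} {N} zero s k<N s<k _ =
  0 , s , <-trans s<k k<N , sum-balanced 0 (<⇒≤ s<k) ,
  λ t → ≤-reflexive (trans (cells≥-balanced₀ t N s) (sym (cells≥-balanced₀ t k s)))
few-rows-above {k} {N} 1 zero k<N _ _ =
  0 , k , k<N , trans (sum-balanced 1 z≤n) (trans (+-identityʳ _) (*-identityˡ k)) ,
  λ t → ≤-reflexive (trans (cells≥-balanced₀ t N k) (sym (cells≥-ones t k)))
few-rows-above {k} 1 (suc s) _ _ m≤k = ⊥-elim (<⇒≱ (<1*+ k (suc s) (s≤s z≤n)) m≤k)
few-rows-above {k} (suc (suc v)) s _ s<k m≤k = ⊥-elim (<⇒≱ (<2*+ k v s (≤-trans (s≤s z≤n) s<k)) m≤k)

almost-full-above : ∀ {k} n s → s < k → k ≤ n → AboveBalanced (suc n) (balanced k n s)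
almost-full-above {k} n s s<k k≤n with m≤n⇒∃[o]m+o≡n s<k
... | o , refl = s + o , n ∸ o , s≤s (m∸n≤m n o) , same-size , λ t → ≤-reflexive (same-profile t)
  where
  o<n : o < n
  o<n = ≤-trans (s≤s (m≤n+m o s)) k≤n
  replicate-+ : ∀ i j {x : ℕ} → replicate (i + j) x ≡ replicate i x ++ replicate j x
  replicate-+ zero    j = refl
  replicate-+ (suc i) j = cong (_ ∷_) (replicate-+ i j)
  same-profile : balanced (suc n) (s + o) (n ∸ o) ≃ balanced (suc s + o) n s
  same-profile t = begin
    cells≥ t (balanced (suc n) (s + o) (n ∸ o))
      ≡⟨ balanced≃rows (s + o) (m≤n⇒m≤1+n (m∸n≤m n o)) t ⟩
    cells≥ t (replicate (s + o) (suc n) ++ [ n ∸ o ])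
      ≡⟨ cong (λ xs → cells≥ t (xs ++ [ n ∸ o ])) (replicate-+ s o) ⟩
    cells≥ t ((replicate s (suc n) ++ replicate o (suc n)) ++ [ n ∸ o ])
      ≡⟨ cong (cells≥ t) (++-assoc (replicate s (suc n)) _ _) ⟩
    cells≥ t (replicate s (suc n) ++ (replicate o (suc n) ++ [ n ∸ o ]))
      ≡⟨ ++⁺-≃ (replicate s (suc n)) (full++short≃uniform n o o<n) t ⟩
    cells≥ t (replicate s (suc n) ++ replicate (suc o) n)
      ≡⟨ cong (λ j → cells≥ t (replicate s (suc n) ++ replicate j n))
              (sym (trans (cong (_∸ s) (sym (+-suc s o))) (m+n∸m≡n s (suc o)))) ⟩
    cells≥ t (balanced (suc s + o) n s) ∎
    where open ≡-Reasoning
  same-size : sum (balanced (suc s + o) n s) ≡ (s + o) * suc n + (n ∸ o)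
  same-size = trans (sym (≃⇒sum≡ {balanced (suc n) (s + o) (n ∸ o)} {balanced (suc s + o) n s} same-profile))
                    (sum-balanced (s + o) (m≤n⇒m≤1+n (m∸n≤m n o)))

full-above : ∀ k N → 0 < N → AboveBalanced N (replicate k N)
full-above k N 0<N = k , 0 , 0<N , trans (sum-replicate k N) (sym (+-identityʳ _)) , λ t → ≤-reflexive (begin
  cells≥ t (balanced N k 0)                     ≡⟨ balanced≃rows k z≤n t ⟩
  cells≥ t (replicate k N ++ [ 0 ])             ≡⟨ cells≥-snoc t (replicate k N) 0 ⟩
  cells≥ t (replicate k N) + (0 ∸ (t ∸ length (replicate k N)))
                                                ≡⟨ cong (cells≥ t (replicate k N) +_) (0∸n≡0 (t ∸ length (replicate k N))) ⟩
  cells≥ t (replicate k N) + 0                  ≡⟨ +-identityʳ _ ⟩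
  cells≥ t (replicate k N)                      ∎)
  where open ≡-Reasoning

module Grid {c n} (1≤c : 1 ≤ c) (c+1<n : suc c < n) (wt : Weight (suc c) (suc n))
            (increasing : RankIncreasing wt) (constant : RankConstant wt) where

  open RankWeight wt increasing constant

  private
    c≤n : c ≤ n
    c≤n = ≤-trans (n≤1+n c) (<⇒≤ c+1<n)

    same-sum : ∀ {A B : Subset (suc c) (suc n)} → size B ≡ size A → sum (heights B) ≡ sum (heights A)
    same-sum {A} {B} eq = trans (sym (size≡sum-heights B)) (trans eq (size≡sum-heights A))

  below-balanced : ∀ {B : Subset (suc c) (suc n)} → Downset B →
                   ∀ Q R → R < suc n → size B ≡ Q * suc n + R → heights B ≼ balanced (suc n) Q R
  below-balanced {B} DB Q R R<n eq =
    square≼balanced (suc n) (NonIncreasing-heights B DB) (≤-trans (≤-reflexive (length-heights B)) (s≤s c≤n))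
      (heights≤ B) Q R R<n (trans (sym (size≡sum-heights B)) eq)

  weight≤ : ∀ {A B} → Downset A → Downset B → size B ≡ size A → heights B ≼ heights A → weight wt B ℚ.≤ weight wt A
  weight≤ {A} {B} DA DB eq B≼A =
    subst₂ ℚ._≤_ (sym (weight≡sumBy ω wt wt≡ω B DB)) (sym (weight≡sumBy ω wt wt≡ω A DA))
      (diagramWeight-mono ω (heights B) (heights A) (same-sum {A} {B} eq) B≼A ω-monotone)

  weight< : ∀ {A B} → Downset A → Downset B → size B ≡ size A → heights A ≼ heights B → heights A ≺ heights B →
            weight wt A ℚ.< weight wt B
  weight< {A} {B} DA DB eq A≼B A≺B =
    subst₂ ℚ._<_ (sym (weight≡sumBy ω wt wt≡ω A DA)) (sym (weight≡sumBy ω wt wt≡ω B DB))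
      (diagramWeight-mono-strict ω (heights A) (heights B) (sym (same-sum {A} {B} eq)) A≼B ω-increasing A≺B)

  optimal-if-above : ∀ {A} → Downset A → AboveBalanced (suc n) (heights A) → Optimal wt A
  optimal-if-above {A} DA (Q , R , R<n , sum≡ , bal≼A) =
    DA , λ B DB eq → weight≤ DA DB eq
      (λ t → ≤-trans (below-balanced DB Q R R<n (trans eq (trans (size≡sum-heights A) sum≡)) t) (bal≼A t))

  lex-optimal : ∀ {A} → Downset A → IsInitialSegment _<L_ A → Optimal wt A
  lex-optimal {A} DA init with LShaped⇒≃balanced (s≤s z≤n) (LShaped-heights A DA init)
  ... | Q , R , R<n , sum≡ , bal≃A = optimal-if-above DA (Q , R , R<n , sum≡ , λ t → ≤-reflexive (bal≃A t))

  module _ {A : Subset (suc c) (suc n)} (DA : Downset A) {v s} (s≤c : s ≤ c)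
           (heights≡ : heights A ≡ balanced (suc c) v s) where

    private
      size≡ : size A ≡ v * suc c + s
      size≡ = trans (size≡sum-heights A) (trans (cong sum heights≡) (sum-balanced v (m≤n⇒m≤1+n s≤c)))

      above : AboveBalanced (suc n) (balanced (suc c) v s) → Optimal wt A
      above = optimal-if-above DA ∘′ subst (AboveBalanced (suc n)) (sym heights≡)

      lead≤ : lead s v ≤ suc n
      lead≤ with balanced (suc c) v s | balanced-∷ c v s | subst (All (_≤ suc n)) heights≡ (heights≤ A)
      ... | _ | refl | h≤ ∷ _ = h≤

    few-rows-optimal : size A ≤ suc c → Optimal wt A
    few-rows-optimal m≤k = above (few-rows-above v s (s≤s (<⇒≤ c+1<n)) (s≤s s≤c) (subst (_≤ suc c) size≡ m≤k))

    many-rows-optimal : size A ≥ suc c * n → Optimal wt A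
    many-rows-optimal m≥kn with m≤n⇒m<n∨m≡n (≤-trans (≤lead s v) lead≤)
    ... | inj₂ refl = above (subst (λ s → AboveBalanced (suc n) (balanced (suc c) (suc n) s))
                                   (sym (lead≤⇒0 s lead≤)) (full-above (suc c) (suc n) (s≤s z≤n)))
      where
      lead≤⇒0 : ∀ s {v} → lead s v ≤ v → s ≡ 0
      lead≤⇒0 zero    _    = refl
      lead≤⇒0 (suc s) v<v = ⊥-elim (<-irrefl refl v<v)
    many-rows-optimal m≥kn | inj₁ (s≤s v≤n) with m≤n⇒m<n∨m≡n v≤n
    ... | inj₂ refl = above (almost-full-above n s (s≤s s≤c) (<⇒≤ c+1<n))
    ... | inj₁ v<n = ⊥-elim (<⇒≱ (remainder-bound v (suc c) s n (s≤s s≤c) v<n)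
                                 (subst₂ _≤_ (*-comm (suc c) n) size≡ m≥kn))

    not-optimal : Optimal wt A → suc c < size A → size A < suc c * n → ⊥
    not-optimal (_ , optimal) lo up = beaten (LShaped⇒≃balanced (s≤s z≤n) (LShaped-heights B DB (IsInitialSegment-lexSegment _ _ m)))
      where
      m = size A
      B = lexSegment (suc c) (suc n) m
      DB = Downset-lexSegment (suc c) (suc n) m
      sizeB : size B ≡ m
      sizeB = size-lexSegment (suc c) (suc n) m (begin
        size A                         ≡⟨ size≡sum-heights A ⟩
        sum (heights A)                ≤⟨ sum≤length*bound (heights A) (heights≤ A) ⟩
        length (heights A) * suc n     ≡⟨ cong (_* suc n) (length-heights A) ⟩
        suc c * suc n                  ∎)
        where open ≤-Reasoning
      beaten : ∃[ Q ] ∃[ R ] (R < suc n × sum (heights B) ≡ Q * suc n + R × balanced (suc n) Q R ≃ heights B) → ⊥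
      beaten (Q , R , R<n , sum≡ , bal≃B) = ℚ.<-irrefl refl (ℚ.<-≤-trans (weight< DA DB sizeB A≼B A≺B) (optimal B DB sizeB))
        where
        total : v * suc c + s ≡ Q * suc n + R
        total = trans (sym size≡) (trans (sym sizeB) (trans (size≡sum-heights B) sum≡))
        A≼B : heights A ≼ heights B
        A≼B t = ≤-trans (below-balanced DA Q R R<n (trans size≡ total) t) (≤-reflexive (bal≃B t))
        A≺B : heights A ≺ heights B
        A≺B with balanced≺balanced c n v s Q R 1≤c (≤-trans (≤-reflexive (+-comm c 2)) c+1<n) s≤c
                   (subst (suc c <_) size≡ lo) (subst₂ _<_ size≡ (*-comm (suc c) n) up) (≤-pred R<n) total
        ... | t , lt = t , subst₂ _<_ (cong (cells≥ t) (sym heights≡)) (bal≃B t) lt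

    optimal⇔ : Optimal wt A ⇔ (size A ≤ suc c ⊎ size A ≥ suc c * n)
    optimal⇔ = mk⇔ to [ few-rows-optimal , many-rows-optimal ]′
      where
      to : Optimal wt A → size A ≤ suc c ⊎ size A ≥ suc c * n
      to opt with size A ≤? suc c | suc c * n ≤? size A
      ... | yes m≤k | _       = inj₁ m≤k
      ... | no  _   | yes m≥kn = inj₂ m≥kn
      ... | no  m≰k | no m≱kn = ⊥-elim (not-optimal opt (≰⇒> m≰k) (≰⇒> m≱kn))

  colex-optimal⇔ : ∀ {A} → Downset A → IsInitialSegment _<C_ A → Optimal wt A ⇔ (size A ≤ suc c ⊎ size A ≥ suc c * n)
  colex-optimal⇔ {A} DA init with balanced-heights A DA init
  ... | v , s , s<k , heights≡ = optimal⇔ DA (≤-pred s<k) heights≡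

corollary4p4 : (ℓ₁ ℓ₂ : ℕ) → 1 < ℓ₁ → ℓ₁ < ℓ₂ ∸ 1 →
    (wt : Weight ℓ₁ ℓ₂) → RankIncreasing wt → RankConstant wt →
    (A : Subset ℓ₁ ℓ₂) → Downset A →
    (IsInitialSegment _<C_ A → (Optimal wt A ⇔ (size A ≤ ℓ₁ ⊎ size A ≥ ℓ₁ * (ℓ₂ ∸ 1))))
    × (IsInitialSegment _<L_ A → Optimal wt A)
corollary4p4 (suc c) (suc n) (s≤s 1≤c) c+1<n wt increasing constant A DA =
  colex-optimal⇔ DA , lex-optimal DA
  where open Grid 1≤c c+1<n wt increasing constant
corollary4p4 (suc c) zero _ () _ _ _ _ _
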